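{- Let $T$ be an unrooted tree and let $I$ be a segment of $T$ of size $\ell\ge 2$. Then there are $t\le 5$ segments $I_1,\ldots,I_t$ of $T$, each of size at most $\ell/2$, such that $I_1,\ldots,I_t$ have pairwise disjoint edge sets and $E(I_1)\cup\cdots\cup E(I_t)=E(I)$.
   Context: For an unrooted tree $T$, a segment of $T$ is a nonempty connected subtree $I$ of $T$ such that at most two vertices of $I$ have a neighbor (in $T$) outside of $I$. The size of $I$ is $|E(I)|$. -}

module Defs where

open import Data.Nat using (ℕ; _≤_; _*_)
open import Data.Fin using (Fin; toℕ)
open import Data.Fin.Subset using (Subset; _∈_; _∉_)
open import Data.Bool using (Bool; true; false; _∧_)
open import Data.List using (List; []; _∷_; length; filter; allFin; cartesianProduct; _++_; [_])
open import Data.List.Relation.Unary.Unique.Propositional using (Unique)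
open import Data.Vec using (lookup)
open import Data.Product using (Σ; ∃; _×_; _,_; proj₁; proj₂)
open import Data.Sum using (_⊎_)
open import Relation.Binary.PropositionalEquality using (_≡_)
open import Relation.Nullary.Decidable using (⌊_⌋)
import Data.Nat as ℕ

record Graph (n : ℕ) : Set where
  field
    Adj    : Fin n → Fin n → Bool
    sym    : ∀ i j → Adj i j ≡ Adj j i
    irrefl : ∀ i → Adj i i ≡ false
open Graph public

module _ {n : ℕ} (G : Graph n) where

  data WalkIn (P : Fin n → Set) : Fin n → Fin n → Set where
    here : ∀ {u} → P u → WalkIn P u u
    step : ∀ {u v w} → P u → Adj G u v ≡ true → WalkIn P v w → WalkIn P u w

  Chain : List (Fin n) → Set
  Chain []           = Data.Unit.⊤ where import Data.Unit
  Chain (x ∷ [])     = Data.Unit.⊤ where import Data.Unit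
  Chain (x ∷ y ∷ xs) = Adj G x y ≡ true × Chain (y ∷ xs)

  Everything : Fin n → Set
  Everything _ = Data.Unit.⊤ where import Data.Unit

  Connected : Set
  Connected = ∀ u v → WalkIn Everything u v

  HasCycle : Set
  HasCycle = Σ (Fin n) λ u → Σ (List (Fin n)) λ xs →
    2 ≤ length xs × Unique (u ∷ xs) × Chain (u ∷ (xs ++ [ u ]))

  IsTree : Set
  IsTree = Connected × (HasCycle → Data.Empty.⊥)
    where import Data.Empty

  -- A subtree is represented by its vertex set S; its edges are all edges of
  -- G with both endpoints in S (connected subgraphs of a tree are induced).
  ConnectedSubtree : Subset n → Set
  ConnectedSubtree S = (∃ λ v → v ∈ S) × (∀ u v → u ∈ S → v ∈ S → WalkIn (_∈ S) u v)

  HasOutsideNeighbour : Subset n → Fin n → Set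
  HasOutsideNeighbour S v = ∃ λ w → Adj G v w ≡ true × w ∉ S

  IsSegment : Subset n → Set
  IsSegment S = ConnectedSubtree S ×
    (Σ (Fin n) λ a → Σ (Fin n) λ b →
      ∀ v → v ∈ S → HasOutsideNeighbour S v → v ≡ a ⊎ v ≡ b)

  edgesOf : Subset n → List (Fin n × Fin n)
  edgesOf S = filter (λ p → ⌊ toℕ (proj₁ p) ℕ.<? toℕ (proj₂ p) ⌋ ∧ Adj G (proj₁ p) (proj₂ p)
                              ∧ lookup S (proj₁ p) ∧ lookup S (proj₂ p) Data.Bool.≟ true)
                     (cartesianProduct (allFin n) (allFin n))
    where import Data.Bool

  size : Subset n → ℕ
  size S = length (edgesOf S)

  EdgeIn : Subset n → Fin n → Fin n → Set
  EdgeIn S u v = Adj G u v ≡ true × u ∈ S × v ∈ S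

-- Put C = ⌊ℓ/2⌋, so that ℓ ≤ 2C + 1; it suffices to cut I into at most five segments with at most C
-- edges each. For x in I, the branches of I at x are the components of I − x, each with x added back;
-- a union of branches at x (a fan) is again a segment when its branches contain at most one exit of I
-- (a vertex with a neighbour outside I). Take x minimising the largest branch containing an exit, among
-- the vertices no branch of which contains both exits. Stepping into a branch that holds more than half
-- of I makes every branch smaller, so at the minimiser each exit branch has at most C + 1 edges. Then
--  * if an exit branch has C + 1 edges, it splits into its first edge and the rest, and all other
--    branches together have at most C edges: 3 segments;
--  * if a branch without exits has more than C edges, its only exit is x and the one-exit version of
--    this argument cuts it into 3; the remaining branches form the fans towards the two exits: 5;
--  * otherwise every branch has at most C edges; the branch towards one exit is a segment, and the fan
--    towards the other is cut into 3 by ordering its branches and cutting where the running total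
--    first exceeds C: 4.
module Submission where

open import Defs hiding (sym)
open import Data.Nat using (ℕ; zero; suc; _≤_; _<_; _*_; _+_; z≤n; s≤s; _∸_)
import Data.Nat.Properties as ℕₚ
open import Data.Fin using (Fin; toℕ; _↑ˡ_; _↑ʳ_; splitAt; join) renaming (_≟_ to _≟ᶠ_)
import Data.Fin.Properties as Finₚ
open import Data.Fin.Subset using (Subset; _∈_; _∉_)
open import Data.Fin.Subset.Properties using (_∈?_)
open import Data.Bool using (Bool; true; false; _∧_; _∨_; not; if_then_else_)
open import Data.Bool.ListAction using (any)
import Data.Bool as Bool
open import Data.List using (List; []; _∷_; length; filter; allFin; cartesianProduct; _++_; [_])
import Data.List as List
import Data.List.Properties as Listₚ
open import Data.List.Relation.Unary.All as All using (All; []; _∷_)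
import Data.List.Relation.Unary.All.Properties as Allₚ
open import Data.List.Relation.Unary.AllPairs using ([]; _∷_)
open import Data.List.Relation.Unary.Any using (here; there)
open import Data.List.Relation.Unary.Unique.Propositional using (Unique)
import Data.List.Relation.Unary.Unique.Propositional.Properties as Uniqueₚ
open import Data.List.Membership.Propositional using () renaming (_∈_ to _∈ˡ_; _∉_ to _∉ˡ_)
import Data.List.Membership.Propositional.Properties as Membershipₚ
import Data.List.Membership.DecPropositional
open import Data.Vec using (lookup; tabulate)
open import Data.List.Extrema.Nat using (max; xs≤max; max<v⁺)
import Data.Vec.Properties as Vecₚ
open import Data.Product
open import Data.Sum using (_⊎_; inj₁; inj₂; [_,_]′)
import Data.Sum as Sum
open import Data.Empty
open import Data.Unit using (tt)
open import Function using (_∘_)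
open import Relation.Binary.PropositionalEquality hiding ([_])
open import Relation.Binary.Definitions using (tri<; tri≈; tri>)
open import Relation.Nullary
open import Relation.Nullary.Decidable using (⌊_⌋; isYes≗does; dec-true; _×-dec_)
open import Algebra.Properties.CommutativeSemigroup ℕₚ.+-commutativeSemigroup using (interchange)

∧-true : ∀ {a b} → a ≡ true → b ≡ true → a ∧ b ≡ true
∧-true refl refl = refl

∧-trueˡ : ∀ {a b} → a ∧ b ≡ true → a ≡ true
∧-trueˡ {true} _ = refl

∧-trueʳ : ∀ {a b} → a ∧ b ≡ true → b ≡ true
∧-trueʳ {true} p = p

∨-trueˡ : ∀ {a b} → a ≡ true → a ∨ b ≡ true
∨-trueˡ refl = refl

∨-trueʳ : ∀ {a b} → b ≡ true → a ∨ b ≡ true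
∨-trueʳ {true} _ = refl
∨-trueʳ {false} p = p

∨-true⁻ : ∀ {a b} → a ∨ b ≡ true → a ≡ true ⊎ b ≡ true
∨-true⁻ {true} _ = inj₁ refl
∨-true⁻ {false} p = inj₂ p

not-true⇒false : ∀ {b} → not b ≡ true → b ≢ true
not-true⇒false {true} () _

false≢true : ∀ {b} → b ≡ false → b ≢ true
false≢true refl ()

⌊⌋-true⁺ : ∀ {P : Set} (P? : Dec P) → P → ⌊ P? ⌋ ≡ true
⌊⌋-true⁺ P? p = trans (isYes≗does P?) (dec-true P? p)

⌊⌋-true⁻ : ∀ {P : Set} (P? : Dec P) → ⌊ P? ⌋ ≡ true → P
⌊⌋-true⁻ (yes p) _ = p

not⌊⌋-true⁺ : ∀ {P : Set} (P? : Dec P) → ¬ P → not ⌊ P? ⌋ ≡ true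
not⌊⌋-true⁺ (yes p) ¬p = ⊥-elim (¬p p)
not⌊⌋-true⁺ (no _) _ = refl

not⌊⌋-true⁻ : ∀ {P : Set} (P? : Dec P) → not ⌊ P? ⌋ ≡ true → ¬ P
not⌊⌋-true⁻ P? np p = not-true⇒false np (⌊⌋-true⁺ P? p)

∈⇒lookup : ∀ {n} {S : Subset n} {v} → v ∈ S → lookup S v ≡ true
∈⇒lookup = Vecₚ.[]=⇒lookup

lookup⇒∈ : ∀ {n} {S : Subset n} {v} → lookup S v ≡ true → v ∈ S
lookup⇒∈ {S = S} {v} = Vecₚ.lookup⇒[]= v S

∈-tabulate⁺ : ∀ {n} {f : Fin n → Bool} {v} → f v ≡ true → v ∈ tabulate f
∈-tabulate⁺ {f = f} {v} e = lookup⇒∈ (trans (Vecₚ.lookup∘tabulate f v) e)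

∈-tabulate⁻ : ∀ {n} {f : Fin n → Bool} {v} → v ∈ tabulate f → f v ≡ true
∈-tabulate⁻ {f = f} {v} m = trans (sym (Vecₚ.lookup∘tabulate f v)) (∈⇒lookup m)

any-true⁻ : ∀ {A : Set} (f : A → Bool) xs → any f xs ≡ true → ∃ λ x → f x ≡ true
any-true⁻ f (x ∷ xs) p with ∨-true⁻ {f x} p
... | inj₁ q = x , q
... | inj₂ q = any-true⁻ f xs q

any-true⁺ : ∀ {A : Set} (f : A → Bool) {xs x} → x ∈ˡ xs → f x ≡ true → any f xs ≡ true
any-true⁺ f (here refl) q = ∨-trueˡ q
any-true⁺ f {y ∷ _} (there m) q = ∨-trueʳ {f y} (any-true⁺ f m q)

anyFin : ∀ {n} → (Fin n → Bool) → Bool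
anyFin {n} f = any f (allFin n)

anyFin-true⁺ : ∀ {n} (f : Fin n → Bool) x → f x ≡ true → anyFin f ≡ true
anyFin-true⁺ f x = any-true⁺ f (Membershipₚ.∈-allFin x)

Unique⇒length≤ : ∀ {n} {xs : List (Fin n)} → Unique xs → length xs ≤ n
Unique⇒length≤ {n} {xs} u with length xs ℕₚ.≤? n
... | yes p = p
... | no np with Finₚ.pigeonhole (ℕₚ.≰⇒> np) (List.lookup xs)
...   | i , j , i<j , e = ⊥-elim (Finₚ.<-irrefl (lookup-injective u i j e) i<j)
  where
    lookup-injective : ∀ {xs : List (Fin n)} → Unique xs → ∀ i j →
                       List.lookup xs i ≡ List.lookup xs j → i ≡ j
    lookup-injective (_ ∷ _) Fin.zero Fin.zero _ = refl
    lookup-injective (h ∷ _) Fin.zero (Fin.suc j) e = ⊥-elim (All.lookup h (Membershipₚ.∈-lookup j) e)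
    lookup-injective (h ∷ _) (Fin.suc i) Fin.zero e = ⊥-elim (All.lookup h (Membershipₚ.∈-lookup i) (sym e))
    lookup-injective (_ ∷ u) (Fin.suc i) (Fin.suc j) e = cong Fin.suc (lookup-injective u i j e)

module Walks {n : ℕ} (G : Graph n) where
  open Data.List.Membership.DecPropositional (_≟ᶠ_ {n}) using () renaming (_∈?_ to _∈ˡ?_)

  adj-sym : ∀ {u v} → Adj G u v ≡ true → Adj G v u ≡ true
  adj-sym {u} {v} a = trans (Graph.sym G v u) a

  adj⇒≢ : ∀ {u v} → Adj G u v ≡ true → u ≢ v
  adj⇒≢ {u} a refl = false≢true (irrefl G u) a

  first : ∀ {P u w} → WalkIn G P u w → P u
  first (here p) = p
  first (step p _ _) = p

  last : ∀ {P u w} → WalkIn G P u w → P w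
  last (here p) = p
  last (step _ _ q) = last q

  weaken : ∀ {P Q : Fin n → Set} {u w} → (∀ z → P z → Q z) → WalkIn G P u w → WalkIn G Q u w
  weaken f (here p) = here (f _ p)
  weaken f (step p a q) = step (f _ p) a (weaken f q)

  _++ʷ_ : ∀ {P u v w} → WalkIn G P u v → WalkIn G P v w → WalkIn G P u w
  here _ ++ʷ q = q
  step p a r ++ʷ q = step p a (r ++ʷ q)

  snoc : ∀ {P u v w} → WalkIn G P u v → Adj G v w ≡ true → P w → WalkIn G P u w
  snoc q a pw = q ++ʷ step (last q) a (here pw)

  reverse : ∀ {P u w} → WalkIn G P u w → WalkIn G P w u
  reverse (here p) = here p
  reverse (step p a q) = snoc (reverse q) (adj-sym a) p

  reachesEnd : ∀ {P u w} → WalkIn G P u w → WalkIn G (λ z → WalkIn G P z w) u w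
  reachesEnd (here p) = here (here p)
  reachesEnd (step p a q) = step (step p a q) a (reachesEnd q)

  departures : ∀ {P u w} → WalkIn G P u w → List (Fin n)
  departures (here _) = []
  departures (step {u = u} _ _ q) = u ∷ departures q

  departures-All : ∀ {P u w} (p : WalkIn G P u w) → All P (departures p)
  departures-All (here _) = []
  departures-All (step pu _ q) = pu ∷ departures-All q

  Simple : ∀ {P u w} → WalkIn G P u w → Set
  Simple {w = w} p = Unique (departures p) × w ∉ˡ departures p

  dropUntil : ∀ {P u v w} (p : WalkIn G P v w) → u ∈ˡ departures p → Simple p → Σ (WalkIn G P u w) Simple
  dropUntil (step pv a q) (here refl) s = step pv a q , s
  dropUntil (step pv a q) (there m) (_ ∷ uq , w∉) = dropUntil q m (uq , λ x → w∉ (there x))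

  shortcut : ∀ {P u w} → WalkIn G P u w → Σ (WalkIn G P u w) Simple
  shortcut (here p) = here p , [] , λ ()
  shortcut {u = u} {w} (step pu a q) with shortcut q
  ... | q′ , s with u ≟ᶠ w
  ...   | yes refl = here pu , [] , λ ()
  ...   | no u≢w with u ∈ˡ? departures q′
  ...     | yes m = dropUntil q′ m s
  ...     | no u∉ = step pu a q′ , (u∉departures ∷ proj₁ s) , λ { (here w≡u) → u≢w (sym w≡u) ; (there x) → proj₂ s x }
    where
      u∉departures : All (u ≢_) (departures q′)
      u∉departures = All.tabulate (λ x∈ u≡x → u∉ (subst (_∈ˡ departures q′) (sym u≡x) x∈))

module Acyclic {n : ℕ} (G : Graph n) (acyclic : HasCycle G → ⊥) where
  open Walks G

  departures-chain : ∀ {P u w y} (q : WalkIn G P u w) → Adj G w y ≡ true → Chain G ((departures q ++ [ w ]) ++ [ y ])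
  departures-chain (here _) b = b , tt
  departures-chain (step _ a (here _)) b = a , b , tt
  departures-chain (step _ a (step pv a′ q)) b = a , departures-chain (step pv a′ q) b

  -- A walk between two neighbours of x avoiding x would close a cycle through x.
  neighbours-separated : ∀ {P : Fin n → Set} {x d₁ d₂} → (∀ z → P z → z ≢ x) →
                         Adj G x d₁ ≡ true → Adj G x d₂ ≡ true → d₁ ≢ d₂ → WalkIn G P d₁ d₂ → ⊥
  neighbours-separated {P} {x} {d₁} {d₂} avoid a₁ a₂ d₁≢d₂ w with shortcut w
  ... | here _ , _ = d₁≢d₂ refl
  ... | q@(step _ _ q′) , unique , d₂∉ =
        acyclic (x , departures q ++ [ d₂ ] , long , unique′ , a₁ , departures-chain q (adj-sym a₂))
    where
      long : 2 ≤ length (departures q ++ [ d₂ ])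
      long rewrite Listₚ.length-++ (departures q′) {[ d₂ ]} | ℕₚ.+-comm (length (departures q′)) 1 =
        s≤s (s≤s z≤n)
      x∉ : All (x ≢_) (departures q ++ [ d₂ ])
      x∉ = Allₚ.++⁺ (All.map (λ pz e → avoid _ pz (sym e)) (departures-All q))
                    ((λ e → avoid d₂ (last q) (sym e)) ∷ [])
      unique′ : Unique (x ∷ (departures q ++ [ d₂ ]))
      unique′ = x∉ ∷ Uniqueₚ.++⁺ unique ([] ∷ []) (λ { (m , here refl) → d₂∉ m })

module Reachability {n : ℕ} (G : Graph n) (p : Fin n → Bool) (d : Fin n) where
  open Walks G

  Allowed : Fin n → Set
  Allowed z = p z ≡ true

  reachesIn : ℕ → Fin n → Bool
  reachesIn zero v = p v ∧ ⌊ v ≟ᶠ d ⌋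
  reachesIn (suc k) v = reachesIn k v ∨ (p v ∧ anyFin (λ u → Adj G v u ∧ reachesIn k u))

  reachesIn-sound : ∀ k v → reachesIn k v ≡ true → WalkIn G Allowed v d
  reachesIn-sound zero v r with ⌊⌋-true⁻ (v ≟ᶠ d) (∧-trueʳ {p v} r)
  ... | refl = here (∧-trueˡ r)
  reachesIn-sound (suc k) v r with ∨-true⁻ {reachesIn k v} r
  ... | inj₁ r′ = reachesIn-sound k v r′
  ... | inj₂ r′ with any-true⁻ (λ u → Adj G v u ∧ reachesIn k u) (allFin n) (∧-trueʳ {p v} r′)
  ...   | u , s = step (∧-trueˡ r′) (∧-trueˡ s) (reachesIn-sound k u (∧-trueʳ {Adj G v u} s))

  reachesIn-complete : ∀ {v} (q : WalkIn G Allowed v d) → reachesIn (length (departures q)) v ≡ true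
  reachesIn-complete (here pd) = ∧-true pd (⌊⌋-true⁺ (d ≟ᶠ d) refl)
  reachesIn-complete {v} (step {v = u} pv a q) =
    ∨-trueʳ {reachesIn k v}
      (∧-true pv (anyFin-true⁺ (λ u → Adj G v u ∧ reachesIn k u) u (∧-true a (reachesIn-complete q))))
    where
      k : ℕ
      k = length (departures q)

  reachesIn-mono : ∀ m k v → reachesIn k v ≡ true → reachesIn (m + k) v ≡ true
  reachesIn-mono zero k v r = r
  reachesIn-mono (suc m) k v r = ∨-trueˡ (reachesIn-mono m k v r)

  -- A simple walk has at most n steps, so n rounds of the search suffice.
  walkIn? : ∀ v → Dec (WalkIn G Allowed v d)
  walkIn? v with reachesIn n v Bool.≟ true
  ... | yes r = yes (reachesIn-sound n v r)
  ... | no ¬r = no λ w → let (q , simple) = shortcut w ; k = length (departures q) in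
        ¬r (subst (λ m → reachesIn m v ≡ true) (ℕₚ.m∸n+n≡m (Unique⇒length≤ (proj₁ simple)))
                  (reachesIn-mono (n ∸ k) k v (reachesIn-complete q)))

-- InBranch x d v: v lies in the component of U ∖ {x} containing the neighbour d of x.
module Branches {n : ℕ} (G : Graph n) (acyclic : HasCycle G → ⊥) (U : Subset n) where
  open Walks G
  open Acyclic G acyclic

  inU∖ : Fin n → Fin n → Bool
  inU∖ x z = lookup U z ∧ not ⌊ z ≟ᶠ x ⌋

  InU∖ : Fin n → Fin n → Set
  InU∖ x z = inU∖ x z ≡ true

  InU∖⁺ : ∀ {x z} → z ∈ U → z ≢ x → InU∖ x z
  InU∖⁺ {x} {z} z∈U z≢x = ∧-true (∈⇒lookup z∈U) (not⌊⌋-true⁺ (z ≟ᶠ x) z≢x)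

  InU∖⇒∈U : ∀ {x z} → InU∖ x z → z ∈ U
  InU∖⇒∈U p = lookup⇒∈ (∧-trueˡ p)

  InU∖⇒≢ : ∀ {x z} → InU∖ x z → z ≢ x
  InU∖⇒≢ {x} {z} p z≡x = not-true⇒false (∧-trueʳ {lookup U z} p) (⌊⌋-true⁺ (z ≟ᶠ x) z≡x)

  InBranch : Fin n → Fin n → Fin n → Set
  InBranch x d v = WalkIn G (InU∖ x) v d

  inBranch? : ∀ x d v → Dec (InBranch x d v)
  inBranch? x d = Reachability.walkIn? G (inU∖ x) d

  InBranch⇒∈U : ∀ {x d v} → InBranch x d v → v ∈ U
  InBranch⇒∈U w = InU∖⇒∈U (first w)

  InBranch⇒≢ : ∀ {x d v} → InBranch x d v → v ≢ x
  InBranch⇒≢ w = InU∖⇒≢ (first w)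

  root∈Branch : ∀ {x d} → d ∈ U → Adj G x d ≡ true → InBranch x d d
  root∈Branch d∈U a = here (InU∖⁺ d∈U (λ d≡x → adj⇒≢ a (sym d≡x)))

  InBranch-extend : ∀ {x d v w} → InBranch x d v → Adj G w v ≡ true → w ∈ U → w ≢ x → InBranch x d w
  InBranch-extend s a w∈U w≢x = step (InU∖⁺ w∈U w≢x) a s

  InBranch-unique : ∀ {x d₁ d₂ v} → Adj G x d₁ ≡ true → Adj G x d₂ ≡ true →
                    InBranch x d₁ v → InBranch x d₂ v → d₁ ≡ d₂
  InBranch-unique {d₁ = d₁} {d₂} a₁ a₂ s₁ s₂ with d₁ ≟ᶠ d₂
  ... | yes d₁≡d₂ = d₁≡d₂
  ... | no d₁≢d₂ = ⊥-elim (neighbours-separated (λ _ → InU∖⇒≢) a₁ a₂ d₁≢d₂ (reverse s₁ ++ʷ s₂))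

  walk⇒InBranch : ∀ {x v} → WalkIn G (_∈ U) v x → v ≢ x → ∃ λ d → Adj G x d ≡ true × d ∈ U × InBranch x d v
  walk⇒InBranch (here _) v≢x = ⊥-elim (v≢x refl)
  walk⇒InBranch {x} (step {u = v} {v = v′} v∈U a q) v≢x with v′ ≟ᶠ x
  ... | yes refl = v , adj-sym a , v∈U , here (InU∖⁺ v∈U v≢x)
  ... | no v′≢x with walk⇒InBranch q v′≢x
  ...   | d , ad , d∈U , s = d , ad , d∈U , step (InU∖⁺ v∈U v≢x) a s

  centre∉farBranch : ∀ {x d e} → x ∈ U → Adj G x d ≡ true → Adj G d e ≡ true → e ≢ x → ¬ InBranch d e x
  centre∉farBranch x∈U ad ade e≢x s = e≢x (InBranch-unique ade (adj-sym ad) s (root∈Branch x∈U (adj-sym ad)))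

  farBranch⊆Branch : ∀ {x d e v} → x ∈ U → d ∈ U → Adj G x d ≡ true → Adj G d e ≡ true → e ≢ x →
                     InBranch d e v → InBranch x d v
  farBranch⊆Branch x∈U d∈U ad ade e≢x (here pe) =
    step (InU∖⁺ (InU∖⇒∈U pe) e≢x) (adj-sym ade) (root∈Branch d∈U ad)
  farBranch⊆Branch x∈U d∈U ad ade e≢x w@(step pv a q) =
    InBranch-extend (farBranch⊆Branch x∈U d∈U ad ade e≢x q) a (InU∖⇒∈U pv)
                    (λ v≡x → centre∉farBranch x∈U ad ade e≢x (subst (InBranch _ _) v≡x w))

  opposite-branches-disjoint : ∀ {x d v} → Adj G x d ≡ true → InBranch x d v → ¬ InBranch d x v
  opposite-branches-disjoint a s (here _) = InBranch⇒≢ s refl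
  opposite-branches-disjoint {x} a s (step {v = v′} pv a′ w) with v′ ≟ᶠ x
  ... | yes refl = InU∖⇒≢ pv (InBranch-unique (adj-sym a′) a (root∈Branch (InU∖⇒∈U pv) (adj-sym a′)) s)
  ... | no v′≢x = opposite-branches-disjoint a (step (InU∖⁺ (InU∖⇒∈U (first w)) v′≢x) (adj-sym a′) s) w

-- Fan x Q: x together with the components of U ∖ {x} containing a neighbour d of x with Q d.
module Fans {n : ℕ} (G : Graph n) (acyclic : HasCycle G → ⊥) (U : Subset n) where
  open Walks G
  open Branches G acyclic U

  InFan : Fin n → (Fin n → Bool) → Fin n → Set
  InFan x Q v = v ≡ x ⊎ ∃ λ d → Q d ≡ true × Adj G x d ≡ true × d ∈ U × InBranch x d v

  abstract
    inFan : Fin n → (Fin n → Bool) → Fin n → Bool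
    inFan x Q v = ⌊ v ≟ᶠ x ⌋ ∨ anyFin (λ d → Q d ∧ Adj G x d ∧ lookup U d ∧ ⌊ inBranch? x d v ⌋)

    Fan : Fin n → (Fin n → Bool) → Subset n
    Fan x Q = tabulate (inFan x Q)

    ∈Fan⁺ : ∀ {x Q v} → InFan x Q v → v ∈ Fan x Q
    ∈Fan⁺ {x} {Q} {v} (inj₁ v≡x) = ∈-tabulate⁺ (∨-trueˡ (⌊⌋-true⁺ (v ≟ᶠ x) v≡x))
    ∈Fan⁺ {x} {Q} {v} (inj₂ (d , qd , ad , d∈U , s)) = ∈-tabulate⁺ (∨-trueʳ {⌊ v ≟ᶠ x ⌋}
      (anyFin-true⁺ _ d (∧-true qd (∧-true ad (∧-true (∈⇒lookup d∈U) (⌊⌋-true⁺ (inBranch? x d v) s))))))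

    ∈Fan⁻ : ∀ {x Q v} → v ∈ Fan x Q → InFan x Q v
    ∈Fan⁻ {x} {Q} {v} m with ∨-true⁻ {⌊ v ≟ᶠ x ⌋} (∈-tabulate⁻ m)
    ... | inj₁ p = inj₁ (⌊⌋-true⁻ (v ≟ᶠ x) p)
    ... | inj₂ p with any-true⁻ (λ d → Q d ∧ Adj G x d ∧ lookup U d ∧ ⌊ inBranch? x d v ⌋) (allFin n) p
    ...   | d , r = inj₂ (d , ∧-trueˡ r , ∧-trueˡ r₁ , lookup⇒∈ (∧-trueˡ r₂) ,
                          ⌊⌋-true⁻ (inBranch? x d v) (∧-trueʳ {lookup U d} r₂))
      where
        r₁ : Adj G x d ∧ lookup U d ∧ ⌊ inBranch? x d v ⌋ ≡ true
        r₁ = ∧-trueʳ {Q d} r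
        r₂ : lookup U d ∧ ⌊ inBranch? x d v ⌋ ≡ true
        r₂ = ∧-trueʳ {Adj G x d} r₁

  centre∈Fan : ∀ {x Q} → x ∈ Fan x Q
  centre∈Fan = ∈Fan⁺ (inj₁ refl)

  Fan⊆U : ∀ {x Q v} → x ∈ U → v ∈ Fan x Q → v ∈ U
  Fan⊆U x∈U m with ∈Fan⁻ m
  ... | inj₁ refl = x∈U
  ... | inj₂ (_ , _ , _ , _ , s) = InBranch⇒∈U s

  walkToCentre : ∀ {x Q v} → v ∈ Fan x Q → WalkIn G (_∈ Fan x Q) v x
  walkToCentre m with ∈Fan⁻ m
  ... | inj₁ refl = here centre∈Fan
  ... | inj₂ (d , qd , ad , d∈U , s) =
    snoc (weaken (λ _ s′ → ∈Fan⁺ (inj₂ (d , qd , ad , d∈U , s′))) (reachesEnd s)) (adj-sym ad) centre∈Fan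

  Fan-connected : ∀ {x Q} → ConnectedSubtree G (Fan x Q)
  Fan-connected {x} = (x , centre∈Fan) , λ u v mu mv → walkToCentre mu ++ʷ reverse (walkToCentre mv)

  Fan-boundary : ∀ {x Q v} → v ∈ Fan x Q → HasOutsideNeighbour G (Fan x Q) v →
                 v ≡ x ⊎ (HasOutsideNeighbour G U v × ∃ λ d → Q d ≡ true × Adj G x d ≡ true × InBranch x d v)
  Fan-boundary m (w , a , w∉) with ∈Fan⁻ m
  ... | inj₁ v≡x = inj₁ v≡x
  ... | inj₂ (d , qd , ad , d∈U , s) = inj₂ ((w , a , w∉U) , d , qd , ad , s)
    where
      w∉U : w ∉ U
      w∉U w∈U with w ≟ᶠ _
      ... | yes w≡x = w∉ (∈Fan⁺ (inj₁ w≡x))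
      ... | no w≢x = w∉ (∈Fan⁺ (inj₂ (d , qd , ad , d∈U , InBranch-extend s (adj-sym a) w∈U w≢x)))

  LeavesU : Fin n → Set
  LeavesU = HasOutsideNeighbour G U

  ExitsAt : Fin n → (Fin n → Bool) → Fin n → Set
  ExitsAt x Q y = ∀ v d → LeavesU v → Q d ≡ true → Adj G x d ≡ true → InBranch x d v → v ≡ y

  Fan-segment : ∀ {x Q y} → ExitsAt x Q y → IsSegment G (Fan x Q)
  Fan-segment {x} {Q} {y} exits = Fan-connected , x , y , boundary
    where
      boundary : ∀ v → v ∈ Fan x Q → HasOutsideNeighbour G (Fan x Q) v → v ≡ x ⊎ v ≡ y
      boundary v m out with Fan-boundary m out
      ... | inj₁ v≡x = inj₁ v≡x
      ... | inj₂ (outU , d , qd , ad , s) = inj₂ (exits v d outU qd ad s)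

  Side : Fin n → Fin n → Fin n → Set
  Side x d u = u ≡ x ⊎ InBranch x d u

  Via : Fin n → (Fin n → Bool) → Fin n → Fin n → Set
  Via x Q u v = ∃ λ d → Q d ≡ true × Adj G x d ≡ true × d ∈ U × Side x d u × Side x d v

  Fan-edge⁻ : ∀ {x Q u v} → EdgeIn G (Fan x Q) u v → Via x Q u v
  Fan-edge⁻ (a , mu , mv) with ∈Fan⁻ mu | ∈Fan⁻ mv
  ... | inj₁ refl | inj₁ refl = ⊥-elim (adj⇒≢ a refl)
  ... | inj₁ refl | inj₂ (d , qd , ad , d∈U , s) = d , qd , ad , d∈U , inj₁ refl , inj₂ s
  ... | inj₂ (d , qd , ad , d∈U , s) | inj₁ refl = d , qd , ad , d∈U , inj₂ s , inj₁ refl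
  ... | inj₂ (d , qd , ad , d∈U , s) | inj₂ (_ , _ , _ , _ , s′) =
        d , qd , ad , d∈U , inj₂ s , inj₂ (InBranch-extend s (adj-sym a) (InBranch⇒∈U s′) (InBranch⇒≢ s′))

  Side⇒∈Fan : ∀ {x Q d u} → Q d ≡ true → Adj G x d ≡ true → d ∈ U → Side x d u → u ∈ Fan x Q
  Side⇒∈Fan qd ad d∈U (inj₁ u≡x) = ∈Fan⁺ (inj₁ u≡x)
  Side⇒∈Fan qd ad d∈U (inj₂ s) = ∈Fan⁺ (inj₂ (_ , qd , ad , d∈U , s))

  Fan-edge⁺ : ∀ {x Q u v} → Adj G u v ≡ true → Via x Q u v → EdgeIn G (Fan x Q) u v
  Fan-edge⁺ a (d , qd , ad , d∈U , su , sv) = a , Side⇒∈Fan qd ad d∈U su , Side⇒∈Fan qd ad d∈U sv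

  Via-unique : ∀ {x d₁ d₂ u v} → Adj G u v ≡ true → Adj G x d₁ ≡ true → Adj G x d₂ ≡ true →
               Side x d₁ u → Side x d₁ v → Side x d₂ u → Side x d₂ v → d₁ ≡ d₂
  Via-unique a a₁ a₂ (inj₂ s₁) _ (inj₂ s₂) _ = InBranch-unique a₁ a₂ s₁ s₂
  Via-unique a a₁ a₂ (inj₂ s₁) _ (inj₁ u≡x) _ = ⊥-elim (InBranch⇒≢ s₁ u≡x)
  Via-unique a a₁ a₂ (inj₁ u≡x) _ (inj₂ s₂) _ = ⊥-elim (InBranch⇒≢ s₂ u≡x)
  Via-unique a a₁ a₂ (inj₁ u≡x) (inj₁ v≡x) _ _ = ⊥-elim (adj⇒≢ a (trans u≡x (sym v≡x)))
  Via-unique a a₁ a₂ (inj₁ _) (inj₂ s₁) (inj₁ _) (inj₂ s₂) = InBranch-unique a₁ a₂ s₁ s₂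
  Via-unique a a₁ a₂ (inj₁ u≡x) (inj₂ _) (inj₁ _) (inj₁ v≡x) = ⊥-elim (adj⇒≢ a (trans u≡x (sym v≡x)))

  Fan-shared-edge : ∀ {x Q₁ Q₂ u v} → EdgeIn G (Fan x Q₁) u v → EdgeIn G (Fan x Q₂) u v →
                    ∃ λ d → Q₁ d ≡ true × Q₂ d ≡ true
  Fan-shared-edge e₁ e₂ with Fan-edge⁻ e₁ | Fan-edge⁻ e₂
  ... | d₁ , q₁ , a₁ , _ , su₁ , sv₁ | d₂ , q₂ , a₂ , _ , su₂ , sv₂
    with Via-unique (proj₁ e₁) a₁ a₂ su₁ sv₁ su₂ sv₂
  ... | refl = d₁ , q₁ , q₂

  module _ (U-connected : ∀ u v → u ∈ U → v ∈ U → WalkIn G (_∈ U) u v) where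
    U-edge⇒Via : ∀ {x u v} → x ∈ U → EdgeIn G U u v →
                 ∃ λ d → Adj G x d ≡ true × d ∈ U × Side x d u × Side x d v
    U-edge⇒Via {x} {u} {v} x∈U (a , u∈U , v∈U) with u ≟ᶠ x
    ... | yes refl with walk⇒InBranch (U-connected v x v∈U x∈U) (λ v≡x → adj⇒≢ a (sym v≡x))
    ...   | d , ad , d∈U , s = d , ad , d∈U , inj₁ refl , inj₂ s
    U-edge⇒Via {x} {u} {v} x∈U (a , u∈U , v∈U) | no u≢x with walk⇒InBranch (U-connected u x u∈U x∈U) u≢x
    ...   | d , ad , d∈U , s with v ≟ᶠ x
    ...     | yes v≡x = d , ad , d∈U , inj₂ s , inj₁ v≡x
    ...     | no v≢x = d , ad , d∈U , inj₂ s , inj₂ (InBranch-extend s (adj-sym a) v∈U v≢x)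

Bool→ℕ : Bool → ℕ
Bool→ℕ true = 1
Bool→ℕ false = 0

count : ∀ {A : Set} → (A → Bool) → List A → ℕ
count f xs = length (filter (λ p → f p Bool.≟ true) xs)

count-∷ : ∀ {A : Set} (f : A → Bool) x xs → count f (x ∷ xs) ≡ Bool→ℕ (f x) + count f xs
count-∷ f x xs with f x
... | true = refl
... | false = refl

count-+≤ : ∀ {A : Set} (f g h k : A → Bool) xs →
           (∀ p → f p ≡ true → h p ≡ true) → (∀ p → g p ≡ true → h p ≡ true) →
           (∀ p → f p ≡ true → g p ≡ true → k p ≡ true) →
           count f xs + count g xs ≤ count h xs + count k xs
count-+≤ f g h k [] _ _ _ = z≤n
count-+≤ f g h k (x ∷ xs) f⊆h g⊆h f∩g⊆k
  rewrite count-∷ f x xs | count-∷ g x xs | count-∷ h x xs | count-∷ k x xs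
        | interchange (Bool→ℕ (f x)) (count f xs) (Bool→ℕ (g x)) (count g xs)
        | interchange (Bool→ℕ (h x)) (count h xs) (Bool→ℕ (k x)) (count k xs)
  = ℕₚ.+-mono-≤ (head (f x) (g x) (h x) (k x) (f⊆h x) (g⊆h x) (f∩g⊆k x)) (count-+≤ f g h k xs f⊆h g⊆h f∩g⊆k)
  where
    head : ∀ a b c d → (a ≡ true → c ≡ true) → (b ≡ true → c ≡ true) → (a ≡ true → b ≡ true → d ≡ true) →
           Bool→ℕ a + Bool→ℕ b ≤ Bool→ℕ c + Bool→ℕ d
    head true true c d ac bc abd rewrite ac refl | abd refl refl = ℕₚ.≤-refl
    head true false c d ac bc abd rewrite ac refl = s≤s z≤n
    head false true c d ac bc abd rewrite bc refl = s≤s z≤n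
    head false false c d ac bc abd = z≤n

count-none : ∀ {A : Set} (f : A → Bool) xs → All (λ y → f y ≢ true) xs → count f xs ≡ 0
count-none f [] _ = refl
count-none f (x ∷ xs) (h ∷ hs) rewrite count-∷ f x xs with f x | h
... | true | h′ = ⊥-elim (h′ refl)
... | false | _ = count-none f xs hs

count-disjoint-+≤ : ∀ {A : Set} (f g h : A → Bool) xs →
                    (∀ p → f p ≡ true → h p ≡ true) → (∀ p → g p ≡ true → h p ≡ true) →
                    (∀ p → f p ≡ true → g p ≢ true) → count f xs + count g xs ≤ count h xs
count-disjoint-+≤ f g h xs f⊆h g⊆h f∩g=∅ = ℕₚ.≤-trans
  (count-+≤ f g h (λ _ → false) xs f⊆h g⊆h (λ p fp gp → ⊥-elim (f∩g=∅ p fp gp)))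
  (ℕₚ.≤-reflexive (trans (cong (count h xs +_) (count-none _ xs (All.tabulate (λ _ ())))) (ℕₚ.+-identityʳ _)))

count-mono : ∀ {A : Set} (f g : A → Bool) xs → (∀ p → f p ≡ true → g p ≡ true) → count f xs ≤ count g xs
count-mono f g xs f⊆g = ℕₚ.≤-trans (ℕₚ.m≤m+n (count f xs) _)
  (count-disjoint-+≤ f (λ _ → false) g xs f⊆g (λ _ ()) (λ _ _ ()))

count≤1 : ∀ {A : Set} (f : A → Bool) xs → Unique xs → (∀ p q → f p ≡ true → f q ≡ true → p ≡ q) →
          count f xs ≤ 1
count≤1 f [] _ _ = z≤n
count≤1 f (x ∷ xs) (x∉ ∷ u) one rewrite count-∷ f x xs with f x in fx
... | true rewrite count-none f xs (All.map (λ x≢y fy → x≢y (one x _ fx fy)) x∉) = s≤s z≤n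
... | false = count≤1 f xs u one

count-pos : ∀ {A : Set} (f : A → Bool) {p} xs → p ∈ˡ xs → f p ≡ true → 1 ≤ count f xs
count-pos f (x ∷ xs) (here refl) fp rewrite count-∷ f x xs | fp = s≤s z≤n
count-pos f (x ∷ xs) (there m) fp rewrite count-∷ f x xs =
  ℕₚ.≤-trans (count-pos f xs m fp) (ℕₚ.m≤n+m (count f xs) (Bool→ℕ (f x)))

module EdgeCount {n : ℕ} (G : Graph n) where
  open Walks G

  pairs : List (Fin n × Fin n)
  pairs = cartesianProduct (allFin n) (allFin n)

  pairs-unique : Unique pairs
  pairs-unique = Uniqueₚ.cartesianProduct⁺ (Uniqueₚ.allFin⁺ n) (Uniqueₚ.allFin⁺ n)

  ∈-pairs : ∀ u v → (u , v) ∈ˡ pairs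
  ∈-pairs u v = Membershipₚ.∈-cartesianProduct⁺ (Membershipₚ.∈-allFin u) (Membershipₚ.∈-allFin v)

  Ordered : Fin n × Fin n → Set
  Ordered (u , v) = toℕ u < toℕ v

  -- size S is by definition the number of ordered pairs accepted by this test.
  isEdgeOf : Subset n → Fin n × Fin n → Bool
  isEdgeOf S (u , v) = ⌊ toℕ u ℕ.<? toℕ v ⌋ ∧ Adj G u v ∧ lookup S u ∧ lookup S v
    where import Data.Nat as ℕ

  isEdgeOf⁺ : ∀ {S u v} → Ordered (u , v) → EdgeIn G S u v → isEdgeOf S (u , v) ≡ true
  isEdgeOf⁺ {u = u} {v} u<v (a , u∈S , v∈S) =
    ∧-true (⌊⌋-true⁺ (toℕ u ℕₚ.<? toℕ v) u<v) (∧-true a (∧-true (∈⇒lookup u∈S) (∈⇒lookup v∈S)))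

  isEdgeOf⁻ : ∀ {S} p → isEdgeOf S p ≡ true → Ordered p × EdgeIn G S (proj₁ p) (proj₂ p)
  isEdgeOf⁻ {S} (u , v) e = ⌊⌋-true⁻ (toℕ u ℕₚ.<? toℕ v) (∧-trueˡ e) , ∧-trueˡ e₁ , lookup⇒∈ (∧-trueˡ e₂) ,
                            lookup⇒∈ (∧-trueʳ {lookup S u} e₂)
    where
      e₁ : Adj G u v ∧ lookup S u ∧ lookup S v ≡ true
      e₁ = ∧-trueʳ {⌊ toℕ u ℕₚ.<? toℕ v ⌋} e
      e₂ : lookup S u ∧ lookup S v ≡ true
      e₂ = ∧-trueʳ {Adj G u v} e₁

  _⊆ᴱ_ : Subset n → Subset n → Set
  A ⊆ᴱ B = ∀ u v → EdgeIn G A u v → EdgeIn G B u v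

  isEdgeOf-mono : ∀ {A B} → A ⊆ᴱ B → ∀ p → isEdgeOf A p ≡ true → isEdgeOf B p ≡ true
  isEdgeOf-mono A⊆B p e = let (ordered , uv) = isEdgeOf⁻ p e in isEdgeOf⁺ ordered (A⊆B _ _ uv)

  EdgeDisjoint : Subset n → Subset n → Set
  EdgeDisjoint A B = ∀ u v → EdgeIn G A u v → EdgeIn G B u v → ⊥

  Ends : Fin n → Fin n → Fin n → Fin n → Set
  Ends x y u v = (u ≡ x × v ≡ y) ⊎ (u ≡ y × v ≡ x)

  ordered-ends-unique : ∀ {x y} p q → Ordered p → Ordered q →
                        Ends x y (proj₁ p) (proj₂ p) → Ends x y (proj₁ q) (proj₂ q) → p ≡ q
  ordered-ends-unique _ _ _ _ (inj₁ (refl , refl)) (inj₁ (refl , refl)) = refl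
  ordered-ends-unique _ _ _ _ (inj₂ (refl , refl)) (inj₂ (refl , refl)) = refl
  ordered-ends-unique _ _ p< q< (inj₁ (refl , refl)) (inj₂ (refl , refl)) = ⊥-elim (ℕₚ.<-asym p< q<)
  ordered-ends-unique _ _ p< q< (inj₂ (refl , refl)) (inj₁ (refl , refl)) = ⊥-elim (ℕₚ.<-asym p< q<)

  size-mono : ∀ {A B} → A ⊆ᴱ B → size G A ≤ size G B
  size-mono {A} {B} A⊆B = count-mono (isEdgeOf A) (isEdgeOf B) pairs (isEdgeOf-mono A⊆B)

  size-empty : ∀ {S} → (∀ u v → ¬ EdgeIn G S u v) → size G S ≡ 0
  size-empty {S} none = count-none (isEdgeOf S) pairs (All.tabulate (λ {p} _ e → none _ _ (proj₂ (isEdgeOf⁻ p e))))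

  size≤1 : ∀ {S x y} → (∀ u v → EdgeIn G S u v → Ends x y u v) → size G S ≤ 1
  size≤1 {S} ends = count≤1 (isEdgeOf S) pairs pairs-unique λ p q ep eq →
    let (p< , p∈) = isEdgeOf⁻ p ep ; (q< , q∈) = isEdgeOf⁻ q eq in
    ordered-ends-unique p q p< q< (ends _ _ p∈) (ends _ _ q∈)

  size-disjoint : ∀ {A B C} → A ⊆ᴱ C → B ⊆ᴱ C → EdgeDisjoint A B → size G A + size G B ≤ size G C
  size-disjoint {A} {B} {C} A⊆C B⊆C disjoint = count-disjoint-+≤ (isEdgeOf A) (isEdgeOf B) (isEdgeOf C) pairs
    (isEdgeOf-mono A⊆C) (isEdgeOf-mono B⊆C)
    (λ p ea eb → disjoint _ _ (proj₂ (isEdgeOf⁻ p ea)) (proj₂ (isEdgeOf⁻ p eb)))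

  size-share-one-edge : ∀ {A B C x y} → A ⊆ᴱ C → B ⊆ᴱ C →
                        (∀ u v → EdgeIn G A u v → EdgeIn G B u v → Ends x y u v) →
                        size G A + size G B ≤ suc (size G C)
  size-share-one-edge {A} {B} {C} A⊆C B⊆C shared = ℕₚ.≤-trans
    (count-+≤ (isEdgeOf A) (isEdgeOf B) (isEdgeOf C) both pairs
              (isEdgeOf-mono A⊆C) (isEdgeOf-mono B⊆C) (λ _ → ∧-true))
    (ℕₚ.≤-trans (ℕₚ.+-monoʳ-≤ (size G C) (count≤1 both pairs pairs-unique one))
                (ℕₚ.≤-reflexive (ℕₚ.+-comm (size G C) 1)))
    where
      both : Fin n × Fin n → Bool
      both p = isEdgeOf A p ∧ isEdgeOf B p
      one : ∀ p q → both p ≡ true → both q ≡ true → p ≡ q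
      one p q ep eq =
        let (p< , pA) = isEdgeOf⁻ p (∧-trueˡ ep) ; (_ , pB) = isEdgeOf⁻ p (∧-trueʳ {isEdgeOf A p} ep)
            (q< , qA) = isEdgeOf⁻ q (∧-trueˡ eq) ; (_ , qB) = isEdgeOf⁻ q (∧-trueʳ {isEdgeOf A q} eq)
        in ordered-ends-unique p q p< q< (shared _ _ pA pB) (shared _ _ qA qB)

  size-missing-edge : ∀ {A B x y} → B ⊆ᴱ A → EdgeIn G A x y → ¬ EdgeIn G B x y → size G B < size G A
  size-missing-edge {A} {B} {x} {y} B⊆A xy∈A xy∉B =
    ℕₚ.<-≤-trans (ℕₚ.m<m+n (size G B) missing-pos)
      (count-disjoint-+≤ (isEdgeOf B) missing (isEdgeOf A) pairs (isEdgeOf-mono B⊆A) (λ _ → ∧-trueˡ)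
                         (λ p eB em → not-true⇒false (∧-trueʳ {isEdgeOf A p} em) eB))
    where
      missing : Fin n × Fin n → Bool
      missing p = isEdgeOf A p ∧ not (isEdgeOf B p)
      missing⁺ : ∀ {u v} → Ordered (u , v) → EdgeIn G A u v → ¬ EdgeIn G B u v → missing (u , v) ≡ true
      missing⁺ {u} {v} u<v uv∈A uv∉B with isEdgeOf B (u , v) in eq
      ... | true = ⊥-elim (uv∉B (proj₂ (isEdgeOf⁻ (u , v) eq)))
      ... | false = ∧-true (isEdgeOf⁺ u<v uv∈A) refl
      flip : ∀ {S u v} → EdgeIn G S u v → EdgeIn G S v u
      flip (a , u∈S , v∈S) = adj-sym a , v∈S , u∈S
      missing-pos : 1 ≤ count missing pairs
      missing-pos with ℕₚ.<-cmp (toℕ x) (toℕ y)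
      ... | tri< x<y _ _ = count-pos missing pairs (∈-pairs x y) (missing⁺ x<y xy∈A xy∉B)
      ... | tri> _ _ y<x = count-pos missing pairs (∈-pairs y x) (missing⁺ y<x (flip xy∈A) (xy∉B ∘ flip))
      ... | tri≈ _ x≡y _ = ⊥-elim (adj⇒≢ (proj₁ xy∈A) (Finₚ.toℕ-injective x≡y))

maxFin : ∀ {n} → (Fin n → ℕ) → ℕ
maxFin {n} f = max 0 (List.map f (allFin n))

≤maxFin : ∀ {n} (f : Fin n → ℕ) x → f x ≤ maxFin f
≤maxFin {n} f x = All.lookup (Allₚ.map⁻ (xs≤max 0 (List.map f (allFin n)))) (Membershipₚ.∈-allFin x)

maxFin< : ∀ {n} (f : Fin n → ℕ) {h} → (∀ x → f x < h) → 0 < h → maxFin f < h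
maxFin< {n} f f<h 0<h = max<v⁺ 0<h (Allₚ.map⁺ (All.tabulate {xs = allFin n} (λ {x} _ → f<h x)))

minimiser : ∀ {n} (D : Fin n → Set) → (∀ x → Dec (D x)) → (Φ : Fin n → ℕ) → ∀ y → D y →
            ∃ λ c → D c × (∀ z → D z → Φ c ≤ Φ z)
minimiser {n} D D? Φ y Dy = descend (Φ y) y Dy ℕₚ.≤-refl
  where
    descend : ∀ k y → D y → Φ y ≤ k → ∃ λ c → D c × (∀ z → D z → Φ c ≤ Φ z)
    descend zero y Dy Φy≤0 = y , Dy , λ _ _ → ℕₚ.≤-trans Φy≤0 z≤n
    descend (suc k) y Dy Φy≤k with Finₚ.any? (λ z → D? z ×-dec (Φ z ℕₚ.≤? k))
    ... | yes (z , Dz , Φz≤k) = descend k z Dz Φz≤k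
    ... | no none = y , Dy , λ z Dz → ℕₚ.≤-trans Φy≤k (ℕₚ.≰⇒> (λ Φz≤k → none (z , Dz , Φz≤k)))

crossing : ∀ (f : ℕ → ℕ) C n → f 0 ≤ C → ∃ λ τ → f τ ≤ C × (τ ≡ n ⊎ C < f (suc τ))
crossing f C n f0≤C = go n 0 refl f0≤C
  where
    go : ∀ m i → i + m ≡ n → f i ≤ C → ∃ λ τ → f τ ≤ C × (τ ≡ n ⊎ C < f (suc τ))
    go zero i i+0≡n fi≤C = i , fi≤C , inj₁ (trans (sym (ℕₚ.+-identityʳ i)) i+0≡n)
    go (suc m) i i+1+m≡n fi≤C with f (suc i) ℕₚ.≤? C
    ... | yes fi+1≤C = go m (suc i) (trans (sym (ℕₚ.+-suc i m)) i+1+m≡n) fi+1≤C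
    ... | no fi+1≰C = i , fi≤C , inj₂ (ℕₚ.≰⇒> fi+1≰C)

halve : ∀ l → ∃ λ C → 2 * C ≤ l × l ≤ suc (2 * C)
halve zero = 0 , z≤n , z≤n
halve (suc zero) = 0 , z≤n , s≤s z≤n
halve (suc (suc l)) with halve l
... | C , 2C≤l , l≤1+2C = suc C , subst (_≤ suc (suc l)) (sym (ℕₚ.*-suc 2 C)) (s≤s (s≤s 2C≤l)) ,
                          subst (suc (suc l) ≤_) (cong suc (sym (ℕₚ.*-suc 2 C))) (s≤s (s≤s l≤1+2C))

2≤1+2c⇒1≤c : ∀ c → 2 ≤ suc (2 * c) → 1 ≤ c
2≤1+2c⇒1≤c zero (s≤s ())
2≤1+2c⇒1≤c (suc c) _ = s≤s z≤n

m+n≤1+2c⇒c<n⇒m≤c : ∀ m n c → m + n ≤ suc (2 * c) → c < n → m ≤ c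
m+n≤1+2c⇒c<n⇒m≤c m n c m+n≤ c<n = ℕₚ.+-cancelʳ-≤ (suc c) m c
  (ℕₚ.≤-trans (ℕₚ.+-monoʳ-≤ m c<n) (subst (m + n ≤_) 1+2c≡c+1+c m+n≤))
  where
    1+2c≡c+1+c : suc (2 * c) ≡ c + suc c
    1+2c≡c+1+c = trans (cong suc (cong (c +_) (ℕₚ.+-identityʳ c))) (sym (ℕₚ.+-suc c c))

2h≤1+s⇒s≤1+2c⇒h≤1+c : ∀ h s c → 2 * h ≤ suc s → s ≤ suc (2 * c) → h ≤ suc c
2h≤1+s⇒s≤1+2c⇒h≤1+c h s c 2h≤1+s s≤1+2c =
  ℕₚ.*-cancelˡ-≤ 2 (ℕₚ.≤-trans 2h≤1+s (subst (suc s ≤_) (sym (ℕₚ.*-suc 2 c)) (s≤s s≤1+2c)))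

m+h≤1+s⇒1+s<2h⇒m<h : ∀ m h s → m + h ≤ suc s → suc s < 2 * h → m < h
m+h≤1+s⇒1+s<2h⇒m<h m h s m+h≤1+s 1+s<2h = ℕₚ.+-cancelʳ-< h m h
  (ℕₚ.<-≤-trans (ℕₚ.≤-<-trans m+h≤1+s 1+s<2h) (ℕₚ.≤-reflexive (cong (h +_) (ℕₚ.+-identityʳ h))))

module Decompositions {n : ℕ} (G : Graph n) where
  open EdgeCount G

  Region : Set₁
  Region = Fin n → Fin n → Set

  record Decomposition (R : Region) (t C : ℕ) : Set where
    field
      piece           : Fin t → Subset n
      piece-segment   : ∀ k → IsSegment G (piece k)
      piece-small     : ∀ k → size G (piece k) ≤ C
      pieces-disjoint : ∀ j k → j ≢ k → EdgeDisjoint (piece j) (piece k)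
      covers          : ∀ u v → R u v → ∃ λ k → EdgeIn G (piece k) u v
      within          : ∀ k u v → EdgeIn G (piece k) u v → R u v

  open Decomposition public

  singleton : ∀ {S C} → IsSegment G S → size G S ≤ C → Decomposition (EdgeIn G S) 1 C
  singleton {S} S-segment S-small = record
    { piece = λ _ → S ; piece-segment = λ _ → S-segment ; piece-small = λ _ → S-small
    ; pieces-disjoint = λ { Fin.zero Fin.zero 0≢0 → ⊥-elim (0≢0 refl) }
    ; covers = λ _ _ e → Fin.zero , e ; within = λ _ _ _ e → e }

  reshape : ∀ {R R′ t C} → (∀ u v → R′ u v → R u v) → (∀ u v → R u v → R′ u v) →
            Decomposition R t C → Decomposition R′ t C
  reshape R′⊆R R⊆R′ D = record
    { piece = piece D ; piece-segment = piece-segment D ; piece-small = piece-small D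
    ; pieces-disjoint = pieces-disjoint D
    ; covers = λ u v r → covers D u v (R′⊆R u v r) ; within = λ k u v e → R⊆R′ u v (within D k u v e) }

  disjoint-union : ∀ {R₁ R₂ t₁ t₂ C} → Decomposition R₁ t₁ C → Decomposition R₂ t₂ C →
                   (∀ u v → R₁ u v → R₂ u v → ⊥) → Decomposition (λ u v → R₁ u v ⊎ R₂ u v) (t₁ + t₂) C
  disjoint-union {R₁} {R₂} {t₁} {t₂} {C} D₁ D₂ disjoint = record
    { piece = piece′ ; piece-segment = segment′ ; piece-small = small′
    ; pieces-disjoint = disjoint′ ; covers = covers′ ; within = within′ }
    where
      pick : Fin t₁ ⊎ Fin t₂ → Subset n
      pick = [ piece D₁ , piece D₂ ]′
      piece′ : Fin (t₁ + t₂) → Subset n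
      piece′ k = pick (splitAt t₁ k)
      segment′ : ∀ k → IsSegment G (piece′ k)
      segment′ k with splitAt t₁ k
      ... | inj₁ i = piece-segment D₁ i
      ... | inj₂ i = piece-segment D₂ i
      small′ : ∀ k → size G (piece′ k) ≤ C
      small′ k with splitAt t₁ k
      ... | inj₁ i = piece-small D₁ i
      ... | inj₂ i = piece-small D₂ i
      within′ : ∀ k u v → EdgeIn G (piece′ k) u v → R₁ u v ⊎ R₂ u v
      within′ k u v e with splitAt t₁ k
      ... | inj₁ i = inj₁ (within D₁ i u v e)
      ... | inj₂ i = inj₂ (within D₂ i u v e)
      covers′ : ∀ u v → R₁ u v ⊎ R₂ u v → ∃ λ k → EdgeIn G (piece′ k) u v
      covers′ u v (inj₁ r) with covers D₁ u v r
      ... | i , e = i ↑ˡ t₂ , subst (λ z → EdgeIn G (pick z) u v) (sym (Finₚ.splitAt-↑ˡ t₁ i t₂)) e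
      covers′ u v (inj₂ r) with covers D₂ u v r
      ... | i , e = t₁ ↑ʳ i , subst (λ z → EdgeIn G (pick z) u v) (sym (Finₚ.splitAt-↑ʳ t₁ t₂ i)) e
      same-split : ∀ j k → splitAt t₁ j ≡ splitAt t₁ k → j ≡ k
      same-split j k eq =
        trans (sym (Finₚ.join-splitAt t₁ t₂ j)) (trans (cong (join t₁ t₂) eq) (Finₚ.join-splitAt t₁ t₂ k))
      disjoint′ : ∀ j k → j ≢ k → EdgeDisjoint (piece′ j) (piece′ k)
      disjoint′ j k j≢k u v ej ek with splitAt t₁ j in eqj | splitAt t₁ k in eqk
      ... | inj₁ i | inj₁ i′ = pieces-disjoint D₁ i i′ (λ { refl → j≢k (same-split j k (trans eqj (sym eqk))) })
                                               u v ej ek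
      ... | inj₂ i | inj₂ i′ = pieces-disjoint D₂ i i′ (λ { refl → j≢k (same-split j k (trans eqj (sym eqk))) })
                                               u v ej ek
      ... | inj₁ i | inj₂ i′ = disjoint u v (within D₁ i u v ej) (within D₂ i′ u v ek)
      ... | inj₂ i | inj₁ i′ = disjoint u v (within D₁ i′ u v ek) (within D₂ i u v ej)

module FanDecompositions {n : ℕ} (G : Graph n) (acyclic : HasCycle G → ⊥) (U : Subset n) where
  open Walks G
  open Branches G acyclic U
  open Fans G acyclic U
  open EdgeCount G
  open Decompositions G

  _⊆Q_ : (Fin n → Bool) → (Fin n → Bool) → Set
  Q₁ ⊆Q Q₂ = ∀ d → Q₁ d ≡ true → Q₂ d ≡ true

  DisjointQ : (Fin n → Bool) → (Fin n → Bool) → Set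
  DisjointQ Q₁ Q₂ = ∀ d → Q₁ d ≡ true → Q₂ d ≡ true → ⊥

  _≡ᵇ_ : Fin n → Fin n → Bool
  e ≡ᵇ d = ⌊ e ≟ᶠ d ⌋

  Branch : Fin n → Fin n → Subset n
  Branch x d = Fan x (_≡ᵇ d)

  Fan-⊆ᴱ : ∀ {x Q₁ Q₂} → Q₁ ⊆Q Q₂ → Fan x Q₁ ⊆ᴱ Fan x Q₂
  Fan-⊆ᴱ Q₁⊆Q₂ u v e with Fan-edge⁻ e
  ... | d , qd , via = Fan-edge⁺ (proj₁ e) (d , Q₁⊆Q₂ d qd , via)

  Fan⊆ᴱU : ∀ {x Q} → x ∈ U → Fan x Q ⊆ᴱ U
  Fan⊆ᴱU x∈U u v (a , mu , mv) = a , Fan⊆U x∈U mu , Fan⊆U x∈U mv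

  Fan-disjoint : ∀ {x Q₁ Q₂} → DisjointQ Q₁ Q₂ → EdgeDisjoint (Fan x Q₁) (Fan x Q₂)
  Fan-disjoint disjoint u v e₁ e₂ = let (d , q₁ , q₂) = Fan-shared-edge e₁ e₂ in disjoint d q₁ q₂

  ExitsAt-mono : ∀ {x Q₁ Q₂ y} → Q₁ ⊆Q Q₂ → ExitsAt x Q₂ y → ExitsAt x Q₁ y
  ExitsAt-mono Q₁⊆Q₂ exits v d out q₁ = exits v d out (Q₁⊆Q₂ d q₁)

  Fan-split : ∀ {x Q t₁ t₂ C} (P : Fin n → Bool) →
              Decomposition (EdgeIn G (Fan x (λ d → Q d ∧ P d))) t₁ C →
              Decomposition (EdgeIn G (Fan x (λ d → Q d ∧ not (P d)))) t₂ C →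
              Decomposition (EdgeIn G (Fan x Q)) (t₁ + t₂) C
  Fan-split {x} {Q} P D₁ D₂ = reshape into from
    (disjoint-union D₁ D₂ (Fan-disjoint (λ d p ¬p → not-true⇒false (∧-trueʳ {Q d} ¬p) (∧-trueʳ {Q d} p))))
    where
      into : ∀ u v → EdgeIn G (Fan x Q) u v →
             EdgeIn G (Fan x (λ d → Q d ∧ P d)) u v ⊎ EdgeIn G (Fan x (λ d → Q d ∧ not (P d))) u v
      into u v e with Fan-edge⁻ e
      ... | d , qd , via with P d in pd
      ...   | true = inj₁ (Fan-edge⁺ (proj₁ e) (d , ∧-true qd pd , via))
      ...   | false = inj₂ (Fan-edge⁺ (proj₁ e) (d , ∧-true qd (cong not pd) , via))
      from : ∀ u v → EdgeIn G (Fan x (λ d → Q d ∧ P d)) u v ⊎ EdgeIn G (Fan x (λ d → Q d ∧ not (P d))) u v →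
             EdgeIn G (Fan x Q) u v
      from u v (inj₁ e) = Fan-⊆ᴱ (λ _ → ∧-trueˡ) u v e
      from u v (inj₂ e) = Fan-⊆ᴱ (λ _ → ∧-trueˡ) u v e

  Fan-beside-large-small : ∀ {S x Q₁ Q₂ C} → Fan x Q₁ ⊆ᴱ S → Fan x Q₂ ⊆ᴱ S → size G S ≤ suc (2 * C) →
                           DisjointQ Q₁ Q₂ → C < size G (Fan x Q₂) → size G (Fan x Q₁) ≤ C
  Fan-beside-large-small {C = C} ⊆S₁ ⊆S₂ S-size disjoint large =
    m+n≤1+2c⇒c<n⇒m≤c _ _ C (ℕₚ.≤-trans (size-disjoint ⊆S₁ ⊆S₂ (Fan-disjoint disjoint)) S-size) large

  Fan-one-branch-small : ∀ {x Q C} →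
                         (∀ d₁ d₂ → Q d₁ ≡ true → Q d₂ ≡ true → Adj G x d₁ ≡ true → Adj G x d₂ ≡ true → d₁ ≡ d₂) →
                         (∀ d → Q d ≡ true → Adj G x d ≡ true → d ∈ U → size G (Branch x d) ≤ C) →
                         size G (Fan x Q) ≤ C
  Fan-one-branch-small {x} {Q} {C} unique small
    with Finₚ.any? (λ d → (Q d Bool.≟ true) ×-dec ((Adj G x d Bool.≟ true) ×-dec (d ∈? U)))
  ... | yes (d , qd , ad , d∈U) = ℕₚ.≤-trans (size-mono Fan⊆ᴱBranch) (small d qd ad d∈U)
    where
      Fan⊆ᴱBranch : Fan x Q ⊆ᴱ Branch x d
      Fan⊆ᴱBranch u v e with Fan-edge⁻ e
      ... | d′ , qd′ , ad′ , via =
        Fan-edge⁺ (proj₁ e) (d′ , ⌊⌋-true⁺ (d′ ≟ᶠ d) (unique d′ d qd′ qd ad′ ad) , ad′ , via)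
  ... | no none = subst (_≤ C) (sym (size-empty λ u v e →
                                       let (d , qd , ad , d∈U , _) = Fan-edge⁻ e in none (d , qd , ad , d∈U))) z≤n

  unique-exit⇒ExitsAt : ∀ {p} → (∀ v → v ∈ U → LeavesU v → v ≡ p) → ∀ {x Q} → ExitsAt x Q p
  unique-exit⇒ExitsAt exit v _ out _ _ s = exit v (InBranch⇒∈U s) out

  below at : ℕ → Fin n → Bool
  below τ d = ⌊ toℕ d ℕₚ.<? τ ⌋
  at τ d = ⌊ toℕ d ℕₚ.≟ τ ⌋

  -- Sort the branches by the index of their root and cut the list where the running total first exceeds C.
  pack-into-three : ∀ {x Q C y} → ExitsAt x Q y →
                    (∀ d → Q d ≡ true → Adj G x d ≡ true → d ∈ U → size G (Branch x d) ≤ C) →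
                    size G (Fan x Q) ≤ suc (2 * C) → Decomposition (EdgeIn G (Fan x Q)) 3 C
  pack-into-three {x} {Q} {C} exits small fan-size
    with crossing (λ τ → size G (Fan x (λ d → Q d ∧ below τ d))) C n none-below-0
    where
      none-below-0 : size G (Fan x (λ d → Q d ∧ below 0 d)) ≤ C
      none-below-0 = subst (_≤ C) (sym (size-empty λ u v e → let (d , q , _) = Fan-edge⁻ e in
                                          ℕₚ.n≮0 (⌊⌋-true⁻ (toℕ d ℕₚ.<? 0) (∧-trueʳ {Q d} q)))) z≤n
  ... | τ , low-small , last-or-crossed =
    Fan-split (below τ) (subFan (λ _ → ∧-trueˡ) low-small)
      (Fan-split (at τ) (subFan (λ _ → ∧-trueˡ ∘ ∧-trueˡ) mid-small)
                        (subFan (λ _ → ∧-trueˡ ∘ ∧-trueˡ) high-small))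
    where
      subFan : ∀ {Q′} → Q′ ⊆Q Q → size G (Fan x Q′) ≤ C → Decomposition (EdgeIn G (Fan x Q′)) 1 C
      subFan Q′⊆Q = singleton (Fan-segment (ExitsAt-mono Q′⊆Q exits))

      High : Fin n → Bool
      High d = (Q d ∧ not (below τ d)) ∧ not (at τ d)

      High⇒τ< : ∀ {d} → High d ≡ true → τ < toℕ d
      High⇒τ< {d} h = ℕₚ.≤∧≢⇒< (ℕₚ.≮⇒≥ (not⌊⌋-true⁻ (toℕ d ℕₚ.<? τ) (∧-trueʳ {Q d} (∧-trueˡ h))))
                                (λ τ≡d → not⌊⌋-true⁻ (toℕ d ℕₚ.≟ τ) (∧-trueʳ {Q d ∧ not (below τ d)} h) (sym τ≡d))

      mid-small : size G (Fan x (λ d → (Q d ∧ not (below τ d)) ∧ at τ d)) ≤ C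
      mid-small = Fan-one-branch-small
        (λ d₁ d₂ q₁ q₂ _ _ → Finₚ.toℕ-injective (trans (⌊⌋-true⁻ (toℕ d₁ ℕₚ.≟ τ) (∧-trueʳ {Q d₁ ∧ _} q₁))
                                                   (sym (⌊⌋-true⁻ (toℕ d₂ ℕₚ.≟ τ) (∧-trueʳ {Q d₂ ∧ _} q₂)))))
        (λ d q → small d (∧-trueˡ (∧-trueˡ q)))

      high-small : size G (Fan x High) ≤ C
      high-small = [ none-high , some-below-1+τ-large ]′ last-or-crossed
        where
        none-high : τ ≡ n → size G (Fan x High) ≤ C
        none-high refl = subst (_≤ C) (sym (size-empty λ u v e → let (d , h , _) = Fan-edge⁻ e in
                                             ℕₚ.<-asym (High⇒τ< h) (Finₚ.toℕ<n d))) z≤n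
        some-below-1+τ-large : C < size G (Fan x (λ d → Q d ∧ below (suc τ) d)) → size G (Fan x High) ≤ C
        some-below-1+τ-large =
          Fan-beside-large-small (Fan-⊆ᴱ (λ _ → ∧-trueˡ ∘ ∧-trueˡ)) (Fan-⊆ᴱ (λ _ → ∧-trueˡ)) fan-size High∩below-1+τ=∅
          where
          High∩below-1+τ=∅ : DisjointQ High (λ d → Q d ∧ below (suc τ) d)
          High∩below-1+τ=∅ d h q =
            ℕₚ.<⇒≱ (High⇒τ< h) (ℕₚ.≤-pred (⌊⌋-true⁻ (toℕ d ℕₚ.<? suc τ) (∧-trueʳ {Q d} q)))

  ≡ᵇ-refl : ∀ {d} → (d ≡ᵇ d) ≡ true
  ≡ᵇ-refl {d} = ⌊⌋-true⁺ (d ≟ᶠ d) refl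

  ≡ᵇ⇒≡ : ∀ {e d} → (e ≡ᵇ d) ≡ true → e ≡ d
  ≡ᵇ⇒≡ {e} {d} = ⌊⌋-true⁻ (e ≟ᶠ d)

  Branch-edge-sides : ∀ {x d u v} → EdgeIn G (Branch x d) u v → Side x d u × Side x d v
  Branch-edge-sides e with Fan-edge⁻ e
  ... | _ , d′≡ᵇd , _ , _ , su , sv with ≡ᵇ⇒≡ d′≡ᵇd
  ...   | refl = su , sv

  edgeSegment : Fin n → Fin n → Subset n
  edgeSegment x d = tabulate (λ v → (v ≡ᵇ x) ∨ (v ≡ᵇ d))

  ∈edgeSegment⁻ : ∀ {x d v} → v ∈ edgeSegment x d → v ≡ x ⊎ v ≡ d
  ∈edgeSegment⁻ {x} {d} {v} m with ∨-true⁻ {v ≡ᵇ x} (∈-tabulate⁻ m)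
  ... | inj₁ p = inj₁ (≡ᵇ⇒≡ p)
  ... | inj₂ p = inj₂ (≡ᵇ⇒≡ p)

  ∈edgeSegmentˡ : ∀ {x d} → x ∈ edgeSegment x d
  ∈edgeSegmentˡ {x} {d} = ∈-tabulate⁺ (∨-trueˡ {x ≡ᵇ x} ≡ᵇ-refl)

  ∈edgeSegmentʳ : ∀ {x d} → d ∈ edgeSegment x d
  ∈edgeSegmentʳ {x} {d} = ∈-tabulate⁺ (∨-trueʳ {d ≡ᵇ x} ≡ᵇ-refl)

  edgeSegment-ends : ∀ {x d u v} → EdgeIn G (edgeSegment x d) u v → Ends x d u v
  edgeSegment-ends (a , mu , mv) with ∈edgeSegment⁻ mu | ∈edgeSegment⁻ mv
  ... | inj₁ refl | inj₁ refl = ⊥-elim (adj⇒≢ a refl)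
  ... | inj₂ refl | inj₂ refl = ⊥-elim (adj⇒≢ a refl)
  ... | inj₁ refl | inj₂ refl = inj₁ (refl , refl)
  ... | inj₂ refl | inj₁ refl = inj₂ (refl , refl)

  edgeSegment-segment : ∀ {x d} → Adj G x d ≡ true → IsSegment G (edgeSegment x d)
  edgeSegment-segment {x} {d} a = ((x , ∈edgeSegmentˡ) , connected) , x , d , (λ v m _ → ∈edgeSegment⁻ m)
    where
      connected : ∀ u v → u ∈ edgeSegment x d → v ∈ edgeSegment x d → WalkIn G (_∈ edgeSegment x d) u v
      connected u v mu mv with ∈edgeSegment⁻ mu | ∈edgeSegment⁻ mv
      ... | inj₁ refl | inj₁ refl = here mu
      ... | inj₂ refl | inj₂ refl = here mu
      ... | inj₁ refl | inj₂ refl = step mu a (here mv)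
      ... | inj₂ refl | inj₁ refl = step mu (adj-sym a) (here mv)

  branchBody : Fin n → Fin n → Subset n
  branchBody x d = tabulate (λ v → ⌊ inBranch? x d v ⌋)

  ∈branchBody⁺ : ∀ {x d v} → InBranch x d v → v ∈ branchBody x d
  ∈branchBody⁺ {x} {d} {v} s = ∈-tabulate⁺ (⌊⌋-true⁺ (inBranch? x d v) s)

  ∈branchBody⁻ : ∀ {x d v} → v ∈ branchBody x d → InBranch x d v
  ∈branchBody⁻ {x} {d} {v} m = ⌊⌋-true⁻ (inBranch? x d v) (∈-tabulate⁻ m)

  branchBody-segment : ∀ {x d y} → Adj G x d ≡ true → d ∈ U → (∀ v → LeavesU v → InBranch x d v → v ≡ y) →
                       IsSegment G (branchBody x d)
  branchBody-segment {x} {d} {y} a d∈U exits =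
    ((d , ∈branchBody⁺ (root∈Branch d∈U a)) , connected) , d , y , boundary
    where
      toRoot : ∀ {v} → v ∈ branchBody x d → WalkIn G (_∈ branchBody x d) v d
      toRoot m = weaken (λ _ → ∈branchBody⁺) (reachesEnd (∈branchBody⁻ m))
      connected : ∀ u v → u ∈ branchBody x d → v ∈ branchBody x d → WalkIn G (_∈ branchBody x d) u v
      connected u v mu mv = toRoot mu ++ʷ reverse (toRoot mv)
      boundary : ∀ v → v ∈ branchBody x d → HasOutsideNeighbour G (branchBody x d) v → v ≡ d ⊎ v ≡ y
      boundary v m (w , av , w∉) with w ∈? U
      ... | no w∉U = inj₂ (exits v (w , av , w∉U) (∈branchBody⁻ m))
      ... | yes w∈U with w ≟ᶠ x
      ...   | yes refl = inj₁ (InBranch-unique (adj-sym av) a (root∈Branch (InBranch⇒∈U (∈branchBody⁻ m)) (adj-sym av))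
                                               (∈branchBody⁻ m))
      ...   | no w≢x = ⊥-elim (w∉ (∈branchBody⁺ (InBranch-extend (∈branchBody⁻ m) (adj-sym av) w∈U w≢x)))

module SegmentSplitting {n : ℕ} (G : Graph n) (acyclic : HasCycle G → ⊥) (U : Subset n)
                        (U-connected : ∀ u v → u ∈ U → v ∈ U → WalkIn G (_∈ U) u v) where
  open Walks G
  open Branches G acyclic U
  open Fans G acyclic U
  open EdgeCount G
  open Decompositions G
  open FanDecompositions G acyclic U

  all : Fin n → Bool
  all _ = true

  U⊆ᴱFan : ∀ {x} → x ∈ U → U ⊆ᴱ Fan x all
  U⊆ᴱFan x∈U u v e with U-edge⇒Via U-connected x∈U e
  ... | d , ad , d∈U , su , sv = Fan-edge⁺ (proj₁ e) (d , refl , ad , d∈U , su , sv)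

  asFan : ∀ {x t C} → x ∈ U → Decomposition (EdgeIn G (Fan x all)) t C → Decomposition (EdgeIn G U) t C
  asFan x∈U = reshape (U⊆ᴱFan x∈U) (Fan⊆ᴱU x∈U)

  module _ {x d} (x∈U : x ∈ U) (ad : Adj G x d ≡ true) (d∈U : d ∈ U) where

    xd∈Branch : EdgeIn G (Branch x d) x d
    xd∈Branch = Fan-edge⁺ ad (d , ≡ᵇ-refl , ad , d∈U , inj₁ refl , inj₂ (root∈Branch d∈U ad))

    branchBody⊆ᴱBranch : branchBody x d ⊆ᴱ Branch x d
    branchBody⊆ᴱBranch u v (a , mu , mv) =
      Fan-edge⁺ a (d , ≡ᵇ-refl , ad , d∈U , inj₂ (∈branchBody⁻ mu) , inj₂ (∈branchBody⁻ mv))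

    x∉branchBody : x ∉ branchBody x d
    x∉branchBody m = InBranch⇒≢ (∈branchBody⁻ m) refl

    Branch-edge⁻ : ∀ {u v} → EdgeIn G (Branch x d) u v →
                   EdgeIn G (edgeSegment x d) u v ⊎ EdgeIn G (branchBody x d) u v
    Branch-edge⁻ e@(a , _) with Branch-edge-sides e
    ... | inj₂ s₁ , inj₂ s₂ = inj₂ (a , ∈branchBody⁺ s₁ , ∈branchBody⁺ s₂)
    ... | inj₁ refl , inj₂ s₂ with InBranch-unique a ad (root∈Branch (InBranch⇒∈U s₂) a) s₂
    ...   | refl = inj₁ (a , ∈edgeSegmentˡ , ∈edgeSegmentʳ)
    Branch-edge⁻ e@(a , _) | inj₂ s₁ , inj₁ refl
      with InBranch-unique (adj-sym a) ad (root∈Branch (InBranch⇒∈U s₁) (adj-sym a)) s₁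
    ...   | refl = inj₁ (a , ∈edgeSegmentʳ , ∈edgeSegmentˡ)
    Branch-edge⁻ e@(a , _) | inj₁ refl , inj₁ refl = ⊥-elim (adj⇒≢ a refl)

    edgeSegment⊆ᴱBranch : edgeSegment x d ⊆ᴱ Branch x d
    edgeSegment⊆ᴱBranch u v e with edgeSegment-ends e
    ... | inj₁ (refl , refl) = xd∈Branch
    ... | inj₂ (refl , refl) = let (a , mx , md) = xd∈Branch in proj₁ e , md , mx

    edge-and-body : ∀ {C y} → 1 ≤ C → size G (Branch x d) ≤ suc C → (∀ v → LeavesU v → InBranch x d v → v ≡ y) →
                    Decomposition (EdgeIn G (Branch x d)) 2 C
    edge-and-body {C} 1≤C small exits =
      reshape (λ _ _ → Branch-edge⁻) (λ u v → [ edgeSegment⊆ᴱBranch u v , branchBody⊆ᴱBranch u v ]′)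
        (disjoint-union (singleton (edgeSegment-segment ad) (ℕₚ.≤-trans (size≤1 (λ _ _ → edgeSegment-ends)) 1≤C))
                        (singleton (branchBody-segment ad d∈U exits) body-small) disjoint)
      where
        body-small : size G (branchBody x d) ≤ C
        body-small = ℕₚ.≤-pred (ℕₚ.<-≤-trans (size-missing-edge branchBody⊆ᴱBranch xd∈Branch
                                                                  (λ e → x∉branchBody (proj₁ (proj₂ e)))) small)
        disjoint : ∀ u v → EdgeIn G (edgeSegment x d) u v → EdgeIn G (branchBody x d) u v → ⊥
        disjoint u v e (_ , mu , mv) with edgeSegment-ends e
        ... | inj₁ (refl , refl) = x∉branchBody mu
        ... | inj₂ (refl , refl) = x∉branchBody mv

    -- A branch of size C + 1 splits into its first edge and the rest; everything else at x fits into C.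
    heavy-branch : ∀ {C y₁ y₂} → 1 ≤ C → size G U ≤ suc (2 * C) →
                   C < size G (Branch x d) → size G (Branch x d) ≤ suc C →
                   ExitsAt x (λ e → not (e ≡ᵇ d)) y₁ → (∀ v → LeavesU v → InBranch x d v → v ≡ y₂) →
                   Decomposition (EdgeIn G U) 3 C
    heavy-branch 1≤C U-size large small exits₁ exits₂ =
      asFan x∈U (Fan-split (_≡ᵇ d) (edge-and-body 1≤C small exits₂)
                   (singleton (Fan-segment exits₁)
                              (Fan-beside-large-small (Fan⊆ᴱU x∈U) (Fan⊆ᴱU x∈U) U-size (λ _ → not-true⇒false) large)))

    farBranch⊆ᴱBranch : ∀ {e} → Adj G d e ≡ true → e ≢ x → Branch d e ⊆ᴱ Branch x d
    farBranch⊆ᴱBranch ade e≢x u v ed =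
      let (su , sv) = Branch-edge-sides ed in Fan-edge⁺ (proj₁ ed) (d , ≡ᵇ-refl , ad , d∈U , toSide su , toSide sv)
      where
        toSide : ∀ {w} → Side d _ w → Side x d w
        toSide (inj₁ refl) = inj₂ (root∈Branch d∈U ad)
        toSide (inj₂ s) = inj₂ (farBranch⊆Branch x∈U d∈U ad ade e≢x s)

    xd∉farBranch : ∀ {e} → Adj G d e ≡ true → e ≢ x → ¬ EdgeIn G (Branch d e) x d
    xd∉farBranch ade e≢x (_ , mx , _) with ∈Fan⁻ mx
    ... | inj₁ x≡d = adj⇒≢ ad x≡d
    ... | inj₂ (_ , e′≡ᵇe , _ , _ , s) with ≡ᵇ⇒≡ e′≡ᵇe
    ...   | refl = centre∉farBranch x∈U ad ade e≢x s

    on-both-sides⇒end : ∀ {w} → Side x d w → Side d x w → w ≡ x ⊎ w ≡ d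
    on-both-sides⇒end (inj₁ w≡x) _ = inj₁ w≡x
    on-both-sides⇒end (inj₂ s) (inj₁ w≡d) = inj₂ w≡d
    on-both-sides⇒end (inj₂ s) (inj₂ s′) = ⊥-elim (opposite-branches-disjoint ad s s′)

    opposite-branches-share-edge : ∀ u v → EdgeIn G (Branch d x) u v → EdgeIn G (Branch x d) u v → Ends x d u v
    opposite-branches-share-edge u v e₁ e₂
      with Branch-edge-sides e₁ | Branch-edge-sides e₂
    ... | su₁ , sv₁ | su₂ , sv₂ with on-both-sides⇒end su₂ su₁ | on-both-sides⇒end sv₂ sv₁
    ...   | inj₁ refl | inj₁ refl = ⊥-elim (adj⇒≢ (proj₁ e₁) refl)
    ...   | inj₂ refl | inj₂ refl = ⊥-elim (adj⇒≢ (proj₁ e₁) refl)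
    ...   | inj₁ refl | inj₂ refl = inj₁ (refl , refl)
    ...   | inj₂ refl | inj₁ refl = inj₂ (refl , refl)

    -- Stepping from x into a branch holding more than half of U, every branch at d is smaller than it:
    -- the branch back towards x shares only the edge xd with it, the others lie inside it.
    branch-shrinks : suc (size G U) < 2 * size G (Branch x d) → ∀ {e} → Adj G d e ≡ true → e ∈ U →
                     size G (Branch d e) < size G (Branch x d)
    branch-shrinks more-than-half {e} ade e∈U with e ≟ᶠ x
    ... | yes refl = m+h≤1+s⇒1+s<2h⇒m<h _ _ _
                       (size-share-one-edge (Fan⊆ᴱU d∈U) (Fan⊆ᴱU x∈U) opposite-branches-share-edge) more-than-half
    ... | no e≢x = size-missing-edge (farBranch⊆ᴱBranch ade e≢x) xd∈Branch (xd∉farBranch ade e≢x)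

  heaviest : (Fin n → Fin n → Bool) → Fin n → ℕ
  heaviest K x = maxFin (λ d → if K x d then size G (Branch x d) else 0)

  -- If the branch at c through d held more than half of U, stepping to d would make every K-branch smaller.
  centroid-balanced : ∀ (D : Fin n → Set) K → (∀ x e → K x e ≡ true → Adj G x e ≡ true × e ∈ U) →
                      ∀ c → c ∈ U → (∀ z → D z → heaviest K c ≤ heaviest K z) →
                      ∀ d → K c d ≡ true → D d → 2 * size G (Branch c d) ≤ suc (size G U)
  centroid-balanced D K K⇒branch c c∈U minimal d kcd Dd with 2 * size G (Branch c d) ℕₚ.≤? suc (size G U)
  ... | yes balanced = balanced
  ... | no unbalanced = ⊥-elim (ℕₚ.<⇒≱ (ℕₚ.<-≤-trans heaviest-d<h h≤heaviest-c) (minimal d Dd))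
    where
      h : ℕ
      h = size G (Branch c d)
      more-than-half : suc (size G U) < 2 * h
      more-than-half = ℕₚ.≰⇒> unbalanced
      0<h : 0 < h
      0<h = ℕₚ.*-cancelˡ-< 2 0 h (ℕₚ.<-trans (s≤s z≤n) more-than-half)
      heaviest-d<h : heaviest K d < h
      heaviest-d<h = maxFin< _ lighter 0<h
        where
          lighter : ∀ e → (if K d e then size G (Branch d e) else 0) < h
          lighter e with K d e in kde
          ... | true = let (ade , e∈U) = K⇒branch d e kde ; (acd , d∈U) = K⇒branch c d kcd in
                       branch-shrinks c∈U acd d∈U more-than-half ade e∈U
          ... | false = 0<h
      h≤heaviest-c : h ≤ heaviest K c
      h≤heaviest-c = subst (_≤ heaviest K c) (cong (if_then h else 0) kcd) (≤maxFin _ d)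

  neighbourInU : Fin n → Fin n → Bool
  neighbourInU x e = Adj G x e ∧ lookup U e

  neighbourInU⁻ : ∀ x e → neighbourInU x e ≡ true → Adj G x e ≡ true × e ∈ U
  neighbourInU⁻ x e k = ∧-trueˡ k , lookup⇒∈ (∧-trueʳ {Adj G x e} k)

  one-exit-from-centre : ∀ {C p c} → c ∈ U → 1 ≤ C → size G U ≤ suc (2 * C) →
                         (∀ v → v ∈ U → LeavesU v → v ≡ p) →
                         (∀ d → Adj G c d ≡ true → d ∈ U → size G (Branch c d) ≤ suc C) →
                         Decomposition (EdgeIn G U) 3 C
  one-exit-from-centre {C} {p} {c} c∈U 1≤C U-size exit branch≤1+C
    with Finₚ.any? (λ d → (Adj G c d Bool.≟ true) ×-dec ((d ∈? U) ×-dec (C ℕₚ.<? size G (Branch c d))))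
  ... | yes (d , ad , d∈U , large) = heavy-branch c∈U ad d∈U 1≤C U-size large (branch≤1+C d ad d∈U)
                                       (unique-exit⇒ExitsAt exit) (λ v out s → exit v (InBranch⇒∈U s) out)
  ... | no none-large = asFan c∈U (pack-into-three (unique-exit⇒ExitsAt exit)
                                    (λ d _ ad d∈U → ℕₚ.≮⇒≥ (λ large → none-large (d , ad , d∈U , large)))
                                    (ℕₚ.≤-trans (size-mono (Fan⊆ᴱU c∈U)) U-size))

  one-exit : ∀ {C p} x₀ → x₀ ∈ U → 1 ≤ C → size G U ≤ suc (2 * C) →
             (∀ v → v ∈ U → LeavesU v → v ≡ p) → Decomposition (EdgeIn G U) 3 C
  one-exit {C} x₀ x₀∈U 1≤C U-size exit with minimiser (_∈ U) (_∈? U) (heaviest neighbourInU) x₀ x₀∈U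
  ... | c , c∈U , minimal = one-exit-from-centre c∈U 1≤C U-size exit λ d ad d∈U →
    2h≤1+s⇒s≤1+2c⇒h≤1+c _ _ C
      (centroid-balanced (_∈ U) neighbourInU neighbourInU⁻ c c∈U minimal d (∧-true ad (∈⇒lookup d∈U)) d∈U)
      U-size

  heavy-branch-with-exit : ∀ {C c d p q} → c ∈ U → 1 ≤ C → size G U ≤ suc (2 * C) →
                           (∀ v → v ∈ U → LeavesU v → v ≡ p ⊎ v ≡ q) →
                           (∀ e → Adj G c e ≡ true → InBranch c e p → ¬ InBranch c e q) →
                           Adj G c d ≡ true → d ∈ U → InBranch c d p →
                           C < size G (Branch c d) → size G (Branch c d) ≤ suc C → Decomposition (EdgeIn G U) 3 C
  heavy-branch-with-exit {c = c} {d} {p} {q} c∈U 1≤C U-size exit separated ad d∈U p∈ large small =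
    heavy-branch c∈U ad d∈U 1≤C U-size large small others this
    where
      others : ExitsAt c (λ e → not (e ≡ᵇ d)) q
      others v e out e≢ᵇd ae s with exit v (InBranch⇒∈U s) out
      ... | inj₁ refl = ⊥-elim (not-true⇒false e≢ᵇd (⌊⌋-true⁺ (e ≟ᶠ d) (InBranch-unique ae ad s p∈)))
      ... | inj₂ v≡q = v≡q
      this : ∀ v → LeavesU v → InBranch c d v → v ≡ p
      this v out s with exit v (InBranch⇒∈U s) out
      ... | inj₁ v≡p = v≡p
      ... | inj₂ refl = ⊥-elim (separated d ad p∈ s)

module TwoExits {n : ℕ} (G : Graph n) (acyclic : HasCycle G → ⊥) (U : Subset n)
                (U-connected : ∀ u v → u ∈ U → v ∈ U → WalkIn G (_∈ U) u v)
                {C : ℕ} (a b : Fin n) (1≤C : 1 ≤ C) (U-size : size G U ≤ suc (2 * C))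
                (exit : ∀ v → v ∈ U → HasOutsideNeighbour G U v → v ≡ a ⊎ v ≡ b) where
  open Walks G
  open Branches G acyclic U
  open Fans G acyclic U
  open EdgeCount G
  open Decompositions G
  open FanDecompositions G acyclic U
  open SegmentSplitting G acyclic U U-connected

  inBranchᵇ : Fin n → Fin n → Fin n → Bool
  inBranchᵇ x e z = ⌊ inBranch? x e z ⌋

  inBranchᵇ⁺ : ∀ {x e z} → InBranch x e z → inBranchᵇ x e z ≡ true
  inBranchᵇ⁺ {x} {e} {z} = ⌊⌋-true⁺ (inBranch? x e z)

  inBranchᵇ⁻ : ∀ {x e z} → inBranchᵇ x e z ≡ true → InBranch x e z
  inBranchᵇ⁻ {x} {e} {z} = ⌊⌋-true⁻ (inBranch? x e z)

  containsExit : Fin n → Fin n → Bool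
  containsExit x e = inBranchᵇ x e a ∨ inBranchᵇ x e b

  exitNeighbour : Fin n → Fin n → Bool
  exitNeighbour x e = Adj G x e ∧ lookup U e ∧ containsExit x e

  exitNeighbour⁻ : ∀ x e → exitNeighbour x e ≡ true → Adj G x e ≡ true × e ∈ U
  exitNeighbour⁻ x e k = ∧-trueˡ k , lookup⇒∈ (∧-trueˡ (∧-trueʳ {Adj G x e} k))

  -- When a, b ∈ U: x lies on the path from a to b.
  Separating : Fin n → Set
  Separating x = ∀ e → Adj G x e ≡ true → InBranch x e a → ¬ InBranch x e b

  separating? : ∀ x → Dec (Separating x)
  separating? x with Finₚ.any? (λ e → (Adj G x e Bool.≟ true) ×-dec (inBranch? x e a ×-dec inBranch? x e b))
  ... | yes (e , ae , a∈ , b∈) = no (λ sep → sep e ae a∈ b∈)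
  ... | no none = yes (λ e ae a∈ b∈ → none (e , ae , a∈ , b∈))

  Separating-step : ∀ {c d} → c ∈ U → Separating c → Adj G c d ≡ true → d ∈ U → containsExit c d ≡ true →
                    Separating d
  Separating-step {c} {d} c∈U sep acd d∈U exit∈ e ade a∈ b∈ with e ≟ᶠ c
  ... | yes refl with ∨-true⁻ {inBranchᵇ c d a} exit∈
  ...   | inj₁ a∈cd = opposite-branches-disjoint acd (inBranchᵇ⁻ a∈cd) a∈
  ...   | inj₂ b∈cd = opposite-branches-disjoint acd (inBranchᵇ⁻ b∈cd) b∈
  Separating-step {c} {d} c∈U sep acd d∈U exit∈ e ade a∈ b∈ | no e≢c =
    sep d acd (farBranch⊆Branch c∈U d∈U acd ade e≢c a∈) (farBranch⊆Branch c∈U d∈U acd ade e≢c b∈)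

  some-separating : ∀ x₀ → x₀ ∈ U → ∃ λ x → x ∈ U × Separating x
  some-separating x₀ x₀∈U with a ∈? U
  ... | yes a∈U = a , a∈U , λ _ _ a∈ _ → InBranch⇒≢ a∈ refl
  ... | no a∉U = x₀ , x₀∈U , λ _ _ a∈ _ → a∉U (InBranch⇒∈U a∈)

  module _ {c} (c∈U : c ∈ U) (separating : Separating c) where

    b-side-exits : ExitsAt c (λ e → inBranchᵇ c e b) b
    b-side-exits v e out b∈ ae s with exit v (InBranch⇒∈U s) out
    ... | inj₁ refl = ⊥-elim (separating e ae s (inBranchᵇ⁻ b∈))
    ... | inj₂ v≡b = v≡b

    a-side-exits : ExitsAt c (λ e → not (inBranchᵇ c e b)) a
    a-side-exits v e out b∉ ae s with exit v (InBranch⇒∈U s) out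
    ... | inj₁ v≡a = v≡a
    ... | inj₂ refl = ⊥-elim (not-true⇒false b∉ (inBranchᵇ⁺ s))

    -- Its only exit is c, so the one-exit case splits it into three.
    heavy-branch-without-exit : ∀ {d} → Adj G c d ≡ true → containsExit c d ≡ false → C < size G (Branch c d) →
                            Decomposition (EdgeIn G U) 5 C
    heavy-branch-without-exit {d} ad exitless large =
      asFan c∈U (Fan-split (_≡ᵇ d) H-decomposition
                  (Fan-split (λ e → inBranchᵇ c e b)
                     (singleton (Fan-segment (ExitsAt-mono (λ _ → ∧-trueʳ) b-side-exits)) (beside-H (λ _ → ∧-trueˡ)))
                     (singleton (Fan-segment (ExitsAt-mono (λ e → ∧-trueʳ {not (e ≡ᵇ d)}) a-side-exits))
                                (beside-H (λ _ → ∧-trueˡ)))))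
      where
        H-exit : ∀ v → v ∈ Branch c d → HasOutsideNeighbour G (Branch c d) v → v ≡ c
        H-exit v m out with Fan-boundary m out
        ... | inj₁ v≡c = v≡c
        ... | inj₂ (outU , d′ , d′≡ᵇd , _ , s) with ≡ᵇ⇒≡ d′≡ᵇd | exit v (InBranch⇒∈U s) outU
        ...   | refl | inj₁ refl = ⊥-elim (false≢true exitless (∨-trueˡ (inBranchᵇ⁺ s)))
        ...   | refl | inj₂ refl = ⊥-elim (false≢true exitless (∨-trueʳ {inBranchᵇ c d a} (inBranchᵇ⁺ s)))
        H-decomposition : Decomposition (EdgeIn G (Branch c d)) 3 C
        H-decomposition = SegmentSplitting.one-exit G acyclic (Branch c d) (proj₂ Fan-connected) c centre∈Fan 1≤C
                            (ℕₚ.≤-trans (size-mono (Fan⊆ᴱU c∈U)) U-size) H-exit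
        beside-H : ∀ {Q} → Q ⊆Q (λ e → not (e ≡ᵇ d)) → size G (Fan c Q) ≤ C
        beside-H Q⊆ = Fan-beside-large-small (Fan⊆ᴱU c∈U) (Fan⊆ᴱU c∈U) U-size
                        (λ e q → not-true⇒false (Q⊆ e q)) large

    heavy-branch-with-a-or-b : ∀ {d} → Adj G c d ≡ true → d ∈ U → containsExit c d ≡ true →
                         C < size G (Branch c d) → size G (Branch c d) ≤ suc C → Decomposition (EdgeIn G U) 3 C
    heavy-branch-with-a-or-b {d} ad d∈U exit∈ with inBranchᵇ c d a in a∈
    ... | true = heavy-branch-with-exit c∈U 1≤C U-size exit separating ad d∈U (inBranchᵇ⁻ a∈)
    ... | false = heavy-branch-with-exit c∈U 1≤C U-size (λ v v∈U out → Sum.swap (exit v v∈U out))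
                    (λ e ae b∈ a∈ → separating e ae a∈ b∈) ad d∈U (inBranchᵇ⁻ exit∈)

    light-branches : (∀ d → Adj G c d ≡ true → d ∈ U → size G (Branch c d) ≤ C) → Decomposition (EdgeIn G U) 4 C
    light-branches small =
      asFan c∈U (Fan-split (λ e → inBranchᵇ c e b)
                   (singleton (Fan-segment b-side-exits) (Fan-one-branch-small b-branch-unique (λ d _ → small d)))
                   (pack-into-three a-side-exits (λ d _ → small d) (ℕₚ.≤-trans (size-mono (Fan⊆ᴱU c∈U)) U-size)))
      where
        b-branch-unique : ∀ d₁ d₂ → inBranchᵇ c d₁ b ≡ true → inBranchᵇ c d₂ b ≡ true →
                          Adj G c d₁ ≡ true → Adj G c d₂ ≡ true → d₁ ≡ d₂
        b-branch-unique d₁ d₂ b∈₁ b∈₂ a₁ a₂ = InBranch-unique a₁ a₂ (inBranchᵇ⁻ b∈₁) (inBranchᵇ⁻ b∈₂)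

    from-centre : (∀ d → Adj G c d ≡ true → d ∈ U → containsExit c d ≡ true → size G (Branch c d) ≤ suc C) →
                  ∃ λ t → t ≤ 5 × Decomposition (EdgeIn G U) t C
    from-centre exit-branch≤1+C
      with Finₚ.any? (λ d → (Adj G c d Bool.≟ true) ×-dec ((containsExit c d Bool.≟ false) ×-dec
                                                           (C ℕₚ.<? size G (Branch c d))))
    ... | yes (d , ad , exitless , large) = 5 , ℕₚ.≤-refl , heavy-branch-without-exit ad exitless large
    ... | no no-heavy-exitless
      with Finₚ.any? (λ d → (Adj G c d Bool.≟ true) ×-dec ((d ∈? U) ×-dec ((containsExit c d Bool.≟ true) ×-dec
                                                           (C ℕₚ.<? size G (Branch c d)))))
    ...   | yes (d , ad , d∈U , exit∈ , large) =
            3 , s≤s (s≤s (s≤s z≤n)) , heavy-branch-with-a-or-b ad d∈U exit∈ large (exit-branch≤1+C d ad d∈U exit∈)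
    ...   | no no-heavy-exit = 4 , s≤s (s≤s (s≤s (s≤s z≤n))) , light-branches small
      where
        small : ∀ d → Adj G c d ≡ true → d ∈ U → size G (Branch c d) ≤ C
        small d ad d∈U with containsExit c d in exit?
        ... | true = ℕₚ.≮⇒≥ (λ large → no-heavy-exit (d , ad , d∈U , exit? , large))
        ... | false = ℕₚ.≮⇒≥ (λ large → no-heavy-exitless (d , ad , exit? , large))

  two-exits : ∀ x₀ → x₀ ∈ U → ∃ λ t → t ≤ 5 × Decomposition (EdgeIn G U) t C
  two-exits x₀ x₀∈U with some-separating x₀ x₀∈U
  ... | y , y∈D with minimiser D (λ x → (x ∈? U) ×-dec separating? x) (heaviest exitNeighbour) y y∈D
    where
      D : Fin n → Set
      D x = x ∈ U × Separating x
  ... | c , (c∈U , separating) , minimal = from-centre c∈U separating λ d ad d∈U exit∈ →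
    2h≤1+s⇒s≤1+2c⇒h≤1+c _ _ C
      (centroid-balanced _ exitNeighbour exitNeighbour⁻ c c∈U minimal d (∧-true ad (∧-true (∈⇒lookup d∈U) exit∈))
                         (d∈U , Separating-step c∈U separating ad d∈U exit∈))
      U-size

lemma3p2 : (n : ℕ) (T : Graph n) → IsTree T → (I : Subset n) → IsSegment T I → 2 ≤ size T I →
    Σ ℕ λ t → t ≤ 5 × Σ (Fin t → Subset n) λ J →
      (∀ k → IsSegment T (J k) × 2 * size T (J k) ≤ size T I) ×
      (∀ j k → ¬ j ≡ k → ∀ u v → EdgeIn T (J j) u v → EdgeIn T (J k) u v → ⊥) ×
      (∀ u v → EdgeIn T I u v → ∃ λ k → EdgeIn T (J k) u v) ×
      (∀ k u v → EdgeIn T (J k) u v → EdgeIn T I u v)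
lemma3p2 n T (_ , acyclic) I (((x₀ , x₀∈I) , I-connected) , a , b , exit) 2≤ℓ =
  let (C , 2C≤ℓ , ℓ≤1+2C) = halve (size T I)
      (t , t≤5 , D) = TwoExits.two-exits T acyclic I I-connected a b (2≤1+2c⇒1≤c C (ℕₚ.≤-trans 2≤ℓ ℓ≤1+2C))
                                         ℓ≤1+2C exit x₀ x₀∈I
      open Decompositions T
  in t , t≤5 , piece D , (λ k → piece-segment D k , ℕₚ.≤-trans (ℕₚ.*-monoʳ-≤ 2 (piece-small D k)) 2C≤ℓ) ,
     pieces-disjoint D , covers D , within D
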